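{- Let $t\ge0$. Let $H_t(z)=\sum_{n\ge1}h_t(n)z^n$, where $h_t(n)$ is the number of $t$-$\mathsf{Pop}$-sortable elements of $V_n$, and let $G_t(z)=\sum_{n\ge1}g_t(n)z^n$, where $g_t(n)$ is the number of irreducible $t$-$\mathsf{Pop}$-sortable elements of $V_n$. Then, as formal power series, $$1+H_t(z)=\frac{1}{1-G_t(z)}.$$
   Context: For $m\ge1$, let $V_m=\mathrm{Vec}(\mathrm{E(NE)}^{m-1})$ be the set of integer vectors $(\mathsf b_0,\dots,\mathsf b_{2m-1})$ such that $\mathsf b_{2k+1}=k$ for $0\le k\le m-1$, $k\le\mathsf b_{2k}\le m-1$ for $0\le k\le m-1$, and whenever $\mathsf b_i=k$ we have $\mathsf b_j\le k$ for all $i+1\le j\le 2k+1$. Ordered componentwise, $V_m$ is a finite lattice isomorphic to the Tamari lattice $\mathrm{Tam}_m$ (so $h_t(n)$ is also the number of $t$-$\mathsf{Pop}$-sortable elements of $\mathrm{Tam}_n$). An element $\vec{\mathsf b}\in V_m$ is irreducible if $\mathsf b_0=\mathsf b_{2m-1}$. For a finite lattice $M$, $\mathsf{Pop}_M(x)=\bigwedge(\{y\in M:y\lessdot x\}\cup\{x\})$, and $x$ is $t$-$\mathsf{Pop}$-sortable if $\mathsf{Pop}_M^t(x)$ is the minimum of $M$. -}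

module Defs where

open import Data.Bool.Base using (Bool; true; false; _∧_; _∨_; not; if_then_else_)
open import Data.Nat.Base using (ℕ; zero; suc; _+_; _*_; _∸_; _≤ᵇ_; _≡ᵇ_)
open import Data.List.Base using (List; []; _∷_; map; concatMap; upTo; filterᵇ; length; zipWith)
open import Data.Bool.ListAction using (all; any; and)
open import Data.Integer.Base as ℤ using (ℤ; +_)

-- Vectors are represented as lists of naturals; V m only contains lists
-- of length 2m.  `b ! i` is the i-th entry (0 when out of range; never
-- used out of range on elements of V m).

_!_ : List ℕ → ℕ → ℕ
[]      ! _     = 0
(x ∷ _) ! zero  = x
(_ ∷ b) ! suc i = b ! i

infixr 5 _⇒ᵇ_
infixl 10 _!_
_⇒ᵇ_ : Bool → Bool → Bool
p ⇒ᵇ q = not p ∨ q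

allLists : ℕ → ℕ → List (List ℕ)
allLists zero    r = [] ∷ []
allLists (suc l) r = concatMap (λ v → map (_∷ v) (upTo r)) (allLists l r)

isV : ℕ → List ℕ → Bool
isV m b =
  (length b ≡ᵇ (2 * m))
  ∧ all (λ k → ((b ! (2 * k + 1)) ≡ᵇ k) ∧ (k ≤ᵇ (b ! (2 * k))) ∧ ((b ! (2 * k)) ≤ᵇ (m ∸ 1))) (upTo m)
  ∧ all (λ i → all (λ j → (((i + 1) ≤ᵇ j) ∧ (j ≤ᵇ (2 * (b ! i) + 1))) ⇒ᵇ ((b ! j) ≤ᵇ (b ! i)))
                   (upTo (2 * m)))
        (upTo (2 * m))

-- the finite set V_m (entries of its elements are all < m)
V : ℕ → List (List ℕ)
V m = filterᵇ (isV m) (allLists (2 * m) m)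

infix 7 _≤V_ _<V_ _≡V_
_≤V_ : List ℕ → List ℕ → Bool
x ≤V y = and (zipWith _≤ᵇ_ x y)

_≡V_ : List ℕ → List ℕ → Bool
x ≡V y = (x ≤V y) ∧ (y ≤V x)

_<V_ : List ℕ → List ℕ → Bool
x <V y = (x ≤V y) ∧ not (y ≤V x)

covBy : ℕ → List ℕ → List ℕ → Bool
covBy m y x = (y <V x) ∧ not (any (λ z → (y <V z) ∧ (z <V x)) (V m))

-- greatest lower bound in V_m of a list S, searched in a candidate list;
-- the default `d` is returned only if no meet exists (never happens, V_m
-- being a lattice).
findMeet : List (List ℕ) → List ℕ → List (List ℕ) → List (List ℕ) → List ℕ
findMeet Vm d S []       = d
findMeet Vm d S (z ∷ zs) =
  if all (λ s → z ≤V s) S ∧ all (λ w → all (λ s → w ≤V s) S ⇒ᵇ (w ≤V z)) Vm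
  then z else findMeet Vm d S zs

meet : ℕ → List ℕ → List (List ℕ) → List ℕ
meet m d S = findMeet (V m) d S (V m)

Pop : ℕ → List ℕ → List ℕ
Pop m x = meet m x (x ∷ filterᵇ (λ y → covBy m y x) (V m))

Pop^ : ℕ → ℕ → List ℕ → List ℕ
Pop^ m zero    x = x
Pop^ m (suc t) x = Pop m (Pop^ m t x)

isMin : ℕ → List ℕ → Bool
isMin m x = all (λ s → x ≤V s) (V m)

sortable : ℕ → ℕ → List ℕ → Bool
sortable m t x = isMin m (Pop^ m t x)

irreducible : ℕ → List ℕ → Bool
irreducible m b = (b ! 0) ≡ᵇ (b ! (2 * m ∸ 1))

h : ℕ → ℕ → ℕ
h t n = length (filterᵇ (sortable n t) (V n))

g : ℕ → ℕ → ℕ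
g t n = length (filterᵇ (λ x → sortable n t x ∧ irreducible n x) (V n))

FPS : Set
FPS = ℕ → ℤ

oneS : FPS
oneS zero    = + 1
oneS (suc _) = + 0

_⊕_ : FPS → FPS → FPS
(A ⊕ B) n = A n ℤ.+ B n

_⊖_ : FPS → FPS → FPS
(A ⊖ B) n = A n ℤ.- B n

sumUpTo : ℕ → (ℕ → ℤ) → ℤ
sumUpTo n f = Data.List.Base.foldr ℤ._+_ (+ 0) (map f (upTo (suc n)))
  where import Data.List.Base

_⊛_ : FPS → FPS → FPS
(A ⊛ B) n = sumUpTo n (λ k → A k ℤ.* B (n ∸ k))

Hs : ℕ → FPS
Hs t zero    = + 0
Hs t (suc n) = + h t (suc n)

Gs : ℕ → FPS
Gs t zero    = + 0
Gs t (suc n) = + g t (suc n)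

{-# OPTIONS --safe #-}
-- If x ∈ V n has first entry c, the nesting condition at position 0 bounds the next 2c + 1
-- entries by c, so x = u ++ (w shifted up by c + 1) with u ∈ V (c + 1) irreducible
-- (u₀ = c = u_{2c+1}) and w ∈ V (n − c − 1); conversely every such pair glues to an element
-- of V n with first entry c.  Below such a concatenation the order is the product order, so a
-- lower cover lowers exactly one block; since meets are componentwise minima, Pop acts
-- blockwise, hence so do its iterates, and the minimum is blockwise too.  Thus x is
-- t-Pop-sortable iff u and w are, which gives h_t(n) = Σ_{c<n} g_t(c + 1) h_t(n − c − 1),
-- the coefficientwise form of (1 + H_t)(1 − G_t) = 1.

module Submission where

open import Defs
open import Data.Bool.Base using (Bool; true; false; _∧_; not; T)
open import Data.Bool.Properties using (T-∧; T?)
open import Data.Empty using (⊥-elim)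
open import Data.List.Base using (List; []; _∷_; _++_; map; concatMap; zipWith; foldr; length; take; drop; upTo; applyUpTo; filterᵇ)
open import Data.Bool.ListAction using (all)
open import Data.List.Properties using (∷-injectiveˡ; ∷-injectiveʳ; map-id; length-++; length-map; length-zipWith; length-take; length-drop; take++drop≡id; ≡-dec)
open import Data.List.Membership.Propositional using (_∈_; find; lose)
open import Data.List.Membership.Propositional.Properties using (∈-filter⁺; ∈-filter⁻; ∈-upTo⁺; ∈-map⁺; ∈-concatMap⁺)
open import Data.List.Relation.Unary.Any as Any using (Any; here; there)
import Data.List.Relation.Unary.All as All
open import Data.List.Relation.Unary.Any.Properties using (any⁺; any⁻)
open import Data.List.Relation.Unary.All.Properties using (all⁺; all⁻; applyUpTo⁺₁; applyUpTo⁻)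
open import Data.Nat.Base using (ℕ; zero; suc; _+_; _*_; _∸_; _≤_; _<_; _⊓_; z≤n; s≤s; _≤ᵇ_; _≡ᵇ_)
open import Data.Nat.Properties
open import Data.Product using (Σ; ∃-syntax; _×_; _,_; proj₁; proj₂)
open import Data.Sum using (_⊎_; inj₁; inj₂; [_,_]′)
open import Function.Base using (id; _∘_; case_of_)
open import Function.Bundles using (_⇔_; mk⇔; Equivalence)
open import Relation.Nullary using (¬_; yes; no)
open import Relation.Nullary.Decidable using (⌊_⌋; toWitness; fromWitness)
open import Relation.Binary.PropositionalEquality
open import Data.Nat.Tactic.RingSolver using (solve-∀)
open import Data.Integer.Base as ℤ using (ℤ) renaming (+_ to ⁺_)
import Data.Integer.Properties as ℤP

open Equivalence using (to; from)

∧-intro : ∀ {a b} → T a → T b → T (a ∧ b)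
∧-intro p q = from T-∧ (p , q)

∧-elim : ∀ {a b} → T (a ∧ b) → T a × T b
∧-elim = to T-∧

not-intro : ∀ {a} → ¬ T a → T (not a)
not-intro {false} _ = _
not-intro {true} ¬t = ¬t _

not-elim : ∀ {a} → T (not a) → ¬ T a
not-elim {false} _ ()

⇒ᵇ-intro : ∀ {a b} → (T a → T b) → T (a ⇒ᵇ b)
⇒ᵇ-intro {false} _ = _
⇒ᵇ-intro {true} f = f _

⇒ᵇ-elim : ∀ {a b} → T (a ⇒ᵇ b) → T a → T b
⇒ᵇ-elim {true} t _ = t

all-upTo⁻ : ∀ {p : ℕ → Bool} n → T (all p (upTo n)) → ∀ {i} → i < n → T (p i)
all-upTo⁻ n t = applyUpTo⁻ id n (all⁺ _ _ t)

all-upTo⁺ : ∀ {p : ℕ → Bool} n → (∀ {i} → i < n → T (p i)) → T (all p (upTo n))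
all-upTo⁺ n f = all⁻ _ (applyUpTo⁺₁ id n f)

all-∈⁻ : ∀ {A : Set} (p : A → Bool) xs {x} → T (all p xs) → x ∈ xs → T (p x)
all-∈⁻ p xs t = All.lookup (all⁺ p xs t)

all-∈⁺ : ∀ {A : Set} (p : A → Bool) xs → (∀ {x} → x ∈ xs → T (p x)) → T (all p xs)
all-∈⁺ p xs f = all⁻ p (All.tabulate f)

∈-filterᵇ⁺ : ∀ {A : Set} (p : A → Bool) xs {x} → x ∈ xs → T (p x) → x ∈ filterᵇ p xs
∈-filterᵇ⁺ p _ = ∈-filter⁺ (T? ∘ p)

∈-filterᵇ⁻ : ∀ {A : Set} (p : A → Bool) xs {x} → x ∈ filterᵇ p xs → x ∈ xs × T (p x)
∈-filterᵇ⁻ p xs = ∈-filter⁻ (T? ∘ p) {xs = xs}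

!-≥length : ∀ (b : List ℕ) {i} → length b ≤ i → b ! i ≡ 0
!-≥length [] _ = refl
!-≥length (x ∷ b) {suc i} (s≤s p) = !-≥length b p

!-++ˡ : ∀ (u : List ℕ) {v i} → i < length u → (u ++ v) ! i ≡ u ! i
!-++ˡ (x ∷ u) {i = zero} _ = refl
!-++ˡ (x ∷ u) {i = suc i} (s≤s p) = !-++ˡ u p

!-++ʳ : ∀ (u : List ℕ) {v L} j → length u ≡ L → (u ++ v) ! (L + j) ≡ v ! j
!-++ʳ [] j refl = refl
!-++ʳ (x ∷ u) j refl = !-++ʳ u j refl

!-map : ∀ (f : ℕ → ℕ) (b : List ℕ) {i} → i < length b → map f b ! i ≡ f (b ! i)
!-map f (x ∷ b) {zero} _ = refl
!-map f (x ∷ b) {suc i} (s≤s p) = !-map f b p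

!-zipWith-⊓ : ∀ (a b : List ℕ) i → zipWith _⊓_ a b ! i ≡ (a ! i) ⊓ (b ! i)
!-zipWith-⊓ [] b i = refl
!-zipWith-⊓ (x ∷ a) [] zero = sym (⊓-zeroʳ x)
!-zipWith-⊓ (x ∷ a) [] (suc i) = sym (⊓-zeroʳ (a ! i))
!-zipWith-⊓ (x ∷ a) (y ∷ b) zero = refl
!-zipWith-⊓ (x ∷ a) (y ∷ b) (suc i) = !-zipWith-⊓ a b i

!-take : ∀ n (b : List ℕ) {i} → i < n → take n b ! i ≡ b ! i
!-take (suc n) [] _ = refl
!-take (suc n) (x ∷ b) {zero} _ = refl
!-take (suc n) (x ∷ b) {suc i} (s≤s p) = !-take n b p

!-drop : ∀ n (b : List ℕ) j → drop n b ! j ≡ b ! (n + j)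
!-drop zero b j = refl
!-drop (suc n) [] j = refl
!-drop (suc n) (x ∷ b) j = !-drop n b j

!-ext : ∀ {a b : List ℕ} → length a ≡ length b → (∀ i → a ! i ≡ b ! i) → a ≡ b
!-ext {[]} {[]} _ _ = refl
!-ext {x ∷ a} {y ∷ b} e f = cong₂ _∷_ (f 0) (!-ext (suc-injective e) (f ∘ suc))

data Cut (k : ℕ) : ℕ → Set where
  before : ∀ {i} → i < k → Cut k i
  after  : ∀ j → Cut k (k + j)

cut : ∀ k i → Cut k i
cut k i with i <? k
... | yes i<k = before i<k
... | no i≮k = subst (Cut k) (m+[n∸m]≡n (≮⇒≥ i≮k)) (after (i ∸ k))

suc[2p+1]≡2[1+p] : ∀ p → suc (2 * p + 1) ≡ 2 * suc p
suc[2p+1]≡2[1+p] = solve-∀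

2[k+q]+1≡2k+[2q+1] : ∀ k q → 2 * (k + q) + 1 ≡ 2 * k + (2 * q + 1)
2[k+q]+1≡2k+[2q+1] = solve-∀

even-or-odd : ∀ i → ∃[ p ] (i ≡ 2 * p ⊎ i ≡ 2 * p + 1)
even-or-odd zero = 0 , inj₁ refl
even-or-odd (suc i) with even-or-odd i
... | p , inj₁ refl = p , inj₂ (+-comm 1 (2 * p))
... | p , inj₂ refl = suc p , inj₁ (suc[2p+1]≡2[1+p] p)

2*-mono-< : ∀ {p m} → p < m → 2 * p < 2 * m
2*-mono-< = *-monoʳ-< 2

2*+1-mono-< : ∀ {p m} → p < m → 2 * p + 1 < 2 * m
2*+1-mono-< {p} p<m = ≤-trans (≤-reflexive (suc[2p+1]≡2[1+p] p)) (*-monoʳ-≤ 2 p<m)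

2*-cancel-< : ∀ {p m} → 2 * p < 2 * m → p < m
2*-cancel-< {p} {m} = *-cancelˡ-< 2 p m

2*+1-cancel-< : ∀ {p m} → 2 * p + 1 < 2 * m → p < m
2*+1-cancel-< {p} lt = 2*-cancel-< (≤-trans (s≤s (m≤m+n (2 * p) 1)) lt)

infix 4 _⊑_ _⊏_

record _⊑_ (a b : List ℕ) : Set where
  constructor pointwise
  field at : ∀ i → a ! i ≤ b ! i

open _⊑_

_⊏_ : List ℕ → List ℕ → Set
a ⊏ b = a ⊑ b × ¬ b ⊑ a

⊑-refl : ∀ {a} → a ⊑ a
⊑-refl = pointwise λ _ → ≤-refl

⊑-antisym : ∀ {a b} → length a ≡ length b → a ⊑ b → b ⊑ a → a ≡ b
⊑-antisym e p q = !-ext e (λ i → ≤-antisym (at p i) (at q i))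

≤V⇔⊑ : ∀ a b → length a ≡ length b → T (a ≤V b) ⇔ a ⊑ b
≤V⇔⊑ a b e = mk⇔ (to′ {a} {b} e) (from′ {a} {b} e)
  where
  to′ : ∀ {a b} → length a ≡ length b → T (a ≤V b) → a ⊑ b
  to′ {[]} {[]} _ _ = ⊑-refl
  to′ {x ∷ a} {y ∷ b} e t = pointwise λ where
    zero → ≤ᵇ⇒≤ x y (proj₁ (∧-elim t))
    (suc i) → at (to′ {a} {b} (suc-injective e) (proj₂ (∧-elim {x ≤ᵇ y} t))) i
  from′ : ∀ {a b} → length a ≡ length b → a ⊑ b → T (a ≤V b)
  from′ {[]} {[]} _ _ = _
  from′ {x ∷ a} {y ∷ b} e p = ∧-intro (≤⇒≤ᵇ (at p 0)) (from′ {a} {b} (suc-injective e) (pointwise (at p ∘ suc)))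

<V⇔⊏ : ∀ a b → length a ≡ length b → T (a <V b) ⇔ a ⊏ b
<V⇔⊏ a b e = mk⇔
  (λ t → let (ab , ¬ba) = ∧-elim {a ≤V b} t in
         to (≤V⇔⊑ a b e) ab , not-elim ¬ba ∘ from (≤V⇔⊑ b a (sym e)))
  (λ (ab , ¬ba) → ∧-intro (from (≤V⇔⊑ a b e) ab) (not-intro (¬ba ∘ to (≤V⇔⊑ b a (sym e)))))

record InV (m : ℕ) (b : List ℕ) : Set where
  field
    length≡ : length b ≡ 2 * m
    odd≡    : ∀ {p} → p < m → b ! (2 * p + 1) ≡ p
    even≥   : ∀ {p} → p < m → p ≤ b ! (2 * p)
    even<   : ∀ {p} → p < m → b ! (2 * p) < m
    nested  : ∀ {i j} → i < j → j ≤ 2 * (b ! i) + 1 → b ! j ≤ b ! i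

  !-beyond : ∀ {i} → 2 * m ≤ i → b ! i ≡ 0
  !-beyond i≥ = !-≥length b (subst (_≤ _) (sym length≡) i≥)

  entry≥ : ∀ {p i} → p < m → i ≡ 2 * p ⊎ i ≡ 2 * p + 1 → p ≤ b ! i
  entry≥ p<m (inj₁ refl) = even≥ p<m
  entry≥ p<m (inj₂ refl) = ≤-reflexive (sym (odd≡ p<m))

  entry< : ∀ {i} → i < 2 * m → b ! i < m
  entry< {i} i< with even-or-odd i
  ... | p , inj₁ refl = even< (2*-cancel-< {p} i<)
  ... | p , inj₂ refl = subst (_< m) (sym (odd≡ p<m)) p<m
    where
    p<m : p < m
    p<m = 2*+1-cancel-< {p} i<

open InV

sameLength : ∀ {m a b} → InV m a → InV m b → length a ≡ length b
sameLength ia ib = trans (length≡ ia) (sym (length≡ ib))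

≤∸1⇒< : ∀ {p a m} → p < m → a ≤ m ∸ 1 → a < m
≤∸1⇒< {m = suc _} _ a≤ = s≤s a≤

isV⇔InV : ∀ m b → T (isV m b) ⇔ InV m b
isV⇔InV m b = mk⇔ to′ from′
  where
  to′ : T (isV m b) → InV m b
  to′ t = record
    { length≡ = ≡ᵇ⇒≡ _ _ tl
    ; odd≡ = λ p<m → ≡ᵇ⇒≡ _ _ (proj₁ (∧-elim (entries p<m)))
    ; even≥ = λ p<m → ≤ᵇ⇒≤ _ _ (proj₁ (∧-elim (proj₂ (∧-elim {b ! _ ≡ᵇ _} (entries p<m)))))
    ; even< = λ {p} p<m → ≤∸1⇒< p<m (≤ᵇ⇒≤ _ _ (proj₂ (∧-elim {p ≤ᵇ _} (proj₂ (∧-elim {b ! _ ≡ᵇ _} (entries p<m))))))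
    ; nested = nested′
    }
    where
    tl : T (length b ≡ᵇ 2 * m)
    tl = proj₁ (∧-elim t)
    t₂ : T (all (λ k → (b ! (2 * k + 1) ≡ᵇ k) ∧ (k ≤ᵇ b ! (2 * k)) ∧ (b ! (2 * k) ≤ᵇ m ∸ 1)) (upTo m))
    t₂ = proj₁ (∧-elim (proj₂ (∧-elim {length b ≡ᵇ 2 * m} t)))
    t₃ : T (all (λ i → all (λ j → ((i + 1) ≤ᵇ j) ∧ (j ≤ᵇ 2 * (b ! i) + 1) ⇒ᵇ (b ! j ≤ᵇ b ! i)) (upTo (2 * m))) (upTo (2 * m)))
    t₃ = proj₂ (∧-elim {all _ (upTo m)} (proj₂ (∧-elim {length b ≡ᵇ 2 * m} t)))
    entries : ∀ {p} → p < m → T ((b ! (2 * p + 1) ≡ᵇ p) ∧ (p ≤ᵇ b ! (2 * p)) ∧ (b ! (2 * p) ≤ᵇ m ∸ 1))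
    entries = all-upTo⁻ m t₂
    nested′ : ∀ {i j} → i < j → j ≤ 2 * (b ! i) + 1 → b ! j ≤ b ! i
    nested′ {i} {j} i<j j≤ with j <? 2 * m
    ... | no j≮ = subst (_≤ _) (sym (!-≥length b (subst (_≤ j) (sym (≡ᵇ⇒≡ _ _ tl)) (≮⇒≥ j≮)))) z≤n
    ... | yes j< = ≤ᵇ⇒≤ _ _ (⇒ᵇ-elim (all-upTo⁻ (2 * m) (all-upTo⁻ (2 * m) t₃ (<-trans i<j j<)) j<)
                              (∧-intro (≤⇒≤ᵇ (subst (_≤ j) (+-comm 1 i) i<j)) (≤⇒≤ᵇ j≤)))
  from′ : InV m b → T (isV m b)
  from′ ib = ∧-intro (≡⇒≡ᵇ _ _ (length≡ ib)) (∧-intro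
    (all-upTo⁺ m λ {p} p<m → ∧-intro (≡⇒≡ᵇ _ _ (odd≡ ib p<m))
                           (∧-intro {p ≤ᵇ b ! (2 * p)} (≤⇒≤ᵇ (even≥ ib p<m)) (≤⇒≤ᵇ (pred-mono-≤ (even< ib p<m)))))
    (all-upTo⁺ (2 * m) λ {i} _ → all-upTo⁺ (2 * m) λ {j} _ →
      ⇒ᵇ-intro {(i + 1 ≤ᵇ j) ∧ (j ≤ᵇ 2 * (b ! i) + 1)} λ t →
      let (i+1≤j , j≤) = ∧-elim t in
      ≤⇒≤ᵇ (nested ib (subst (_≤ j) (+-comm i 1) (≤ᵇ⇒≤ _ _ i+1≤j)) (≤ᵇ⇒≤ _ _ j≤))))

∈-allLists : ∀ {l r} (y : List ℕ) → length y ≡ l → (∀ {i} → i < l → y ! i < r) → y ∈ allLists l r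
∈-allLists {zero} [] _ _ = here refl
∈-allLists {suc l} {r} (c ∷ v) e bound =
  ∈-concatMap⁺ (λ w → map (_∷ w) (upTo r)) (Any.map (λ { refl → ∈-map⁺ (_∷ v) (∈-upTo⁺ (bound {0} (s≤s z≤n))) })
    (∈-allLists v (suc-injective e) (bound ∘ s≤s)))

∈V⇔InV : ∀ m b → b ∈ V m ⇔ InV m b
∈V⇔InV m b = mk⇔
  (to (isV⇔InV m b) ∘ proj₂ ∘ ∈-filterᵇ⁻ (isV m) (allLists (2 * m) m))
  (λ ib → ∈-filterᵇ⁺ (isV m) (allLists (2 * m) m) (∈-allLists b (length≡ ib) (entry< ib)) (from (isV⇔InV m b) ib))

-- Meets in V m are componentwise minima, and Pop is such a meet

InV-⊓ : ∀ {m a b} → InV m a → InV m b → InV m (zipWith _⊓_ a b)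
InV-⊓ {m} {a} {b} ia ib = record
  { length≡ = trans (length-zipWith _⊓_ a b) (trans (cong (_⊓ length b) (sameLength ia ib)) (trans (⊓-idem (length b)) (length≡ ib)))
  ; odd≡ = λ p<m → trans (!-zipWith-⊓ a b _) (trans (cong₂ _⊓_ (odd≡ ia p<m) (odd≡ ib p<m)) (⊓-idem _))
  ; even≥ = λ p<m → subst (_ ≤_) (sym (!-zipWith-⊓ a b _)) (⊓-glb (even≥ ia p<m) (even≥ ib p<m))
  ; even< = λ p<m → subst (_< m) (sym (!-zipWith-⊓ a b _)) (≤-<-trans (m⊓n≤m _ _) (even< ia p<m))
  ; nested = nested′
  }
  where
  nested′ : ∀ {i j} → i < j → j ≤ 2 * (zipWith _⊓_ a b ! i) + 1 → zipWith _⊓_ a b ! j ≤ zipWith _⊓_ a b ! i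
  nested′ {i} {j} i<j j≤ rewrite !-zipWith-⊓ a b i | !-zipWith-⊓ a b j with ⊓-sel (a ! i) (b ! i)
  ... | inj₁ eq rewrite eq = ≤-trans (m⊓n≤m _ _) (nested ia i<j j≤)
  ... | inj₂ eq rewrite eq = ≤-trans (m⊓n≤n _ _) (nested ib i<j j≤)

⋀ : List ℕ → List (List ℕ) → List ℕ
⋀ = foldr (zipWith _⊓_)

⋀-lower : ∀ x ys {s} → s ∈ x ∷ ys → ⋀ x ys ⊑ s
⋀-lower x [] (here refl) = ⊑-refl
⋀-lower x (y ∷ ys) (here refl) = pointwise λ i → subst (_≤ x ! i) (sym (!-zipWith-⊓ y (⋀ x ys) i))
  (≤-trans (m⊓n≤n _ _) (at (⋀-lower x ys (here refl)) i))
⋀-lower x (y ∷ ys) (there (here refl)) = pointwise λ i → subst (_≤ y ! i) (sym (!-zipWith-⊓ y (⋀ x ys) i)) (m⊓n≤m _ _)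
⋀-lower x (y ∷ ys) (there (there s∈)) = pointwise λ i → subst (_≤ _) (sym (!-zipWith-⊓ y (⋀ x ys) i))
  (≤-trans (m⊓n≤n _ _) (at (⋀-lower x ys (there s∈)) i))

⋀-greatest : ∀ x ys {z} → (∀ {s} → s ∈ x ∷ ys → z ⊑ s) → z ⊑ ⋀ x ys
⋀-greatest x [] lb = lb (here refl)
⋀-greatest x (y ∷ ys) {z} lb = pointwise λ i → subst (_ ≤_) (sym (!-zipWith-⊓ y (⋀ x ys) i))
  (⊓-glb (at (lb (there (here refl))) i) (at (⋀-greatest x ys lb′) i))
  where
  lb′ : ∀ {s} → s ∈ x ∷ ys → z ⊑ s
  lb′ (here refl) = lb (here refl)
  lb′ (there s∈) = lb (there (there s∈))

InV-⋀ : ∀ {m x} ys → InV m x → (∀ {y} → y ∈ ys → InV m y) → InV m (⋀ x ys)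
InV-⋀ [] ix _ = ix
InV-⋀ (y ∷ ys) ix iys = InV-⊓ (iys (here refl)) (InV-⋀ ys ix (iys ∘ there))

record IsGlb (m : ℕ) (S : List (List ℕ)) (z : List ℕ) : Set where
  field
    glb∈V    : InV m z
    lower    : ∀ {s} → s ∈ S → z ⊑ s
    greatest : ∀ {w} → InV m w → (∀ {s} → s ∈ S → w ⊑ s) → w ⊑ z

open IsGlb

⋀-isGlb : ∀ {m} x ys → InV m x → (∀ {y} → y ∈ ys → InV m y) → IsGlb m (x ∷ ys) (⋀ x ys)
⋀-isGlb x ys ix iys = record
  { glb∈V = InV-⋀ ys ix iys
  ; lower = ⋀-lower x ys
  ; greatest = λ _ → ⋀-greatest x ys
  }

meetCond : List (List ℕ) → List (List ℕ) → List ℕ → Bool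
meetCond Vm S z = all (λ s → z ≤V s) S ∧ all (λ w → all (λ s → w ≤V s) S ⇒ᵇ (w ≤V z)) Vm

findMeet-sound : ∀ {Vm d S} L → Any (T ∘ meetCond Vm S) L →
                 findMeet Vm d S L ∈ L × T (meetCond Vm S (findMeet Vm d S L))
findMeet-sound {Vm} {d} {S} (z ∷ zs) found with meetCond Vm S z in eq
... | true = here refl , subst T (sym eq) _
... | false with found
... | here t = ⊥-elim (subst T eq t)
... | there found′ = let (r∈ , t) = findMeet-sound zs found′ in there r∈ , t

meetCond⇔IsGlb : ∀ {m S z} → (∀ {s} → s ∈ S → InV m s) → InV m z → T (meetCond (V m) S z) ⇔ IsGlb m S z
meetCond⇔IsGlb {m} {S} {z} iS iz = mk⇔ to′ from′
  where
  ⊑⇔ : ∀ {a b} → InV m a → InV m b → T (a ≤V b) ⇔ a ⊑ b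
  ⊑⇔ {a} {b} ia ib = ≤V⇔⊑ a b (sameLength ia ib)
  to′ : T (meetCond (V m) S z) → IsGlb m S z
  to′ t = let (t₁ , t₂) = ∧-elim t in record
    { glb∈V = iz
    ; lower = λ s∈ → to (⊑⇔ iz (iS s∈)) (all-∈⁻ _ S t₁ s∈)
    ; greatest = λ {w} iw lb → to (⊑⇔ iw iz) (⇒ᵇ-elim (all-∈⁻ _ (V m) t₂ (from (∈V⇔InV m w) iw))
                                   (all-∈⁺ _ S λ s∈ → from (⊑⇔ iw (iS s∈)) (lb s∈)))
    }
  from′ : IsGlb m S z → T (meetCond (V m) S z)
  from′ g = ∧-intro
    (all-∈⁺ _ S λ s∈ → from (⊑⇔ iz (iS s∈)) (lower g s∈))
    (all-∈⁺ _ (V m) λ {w} w∈ → ⇒ᵇ-intro λ t →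
       let iw = to (∈V⇔InV m w) w∈ in
       from (⊑⇔ iw iz) (greatest g iw λ s∈ → to (⊑⇔ iw (iS s∈)) (all-∈⁻ _ S t s∈)))

meet-isGlb : ∀ {m d S z} → (∀ {s} → s ∈ S → InV m s) → IsGlb m S z → IsGlb m S (meet m d S)
meet-isGlb {m} {d} {S} iS g =
  let (r∈ , t) = findMeet-sound {d = d} (V m) (lose (from (∈V⇔InV m _) (glb∈V g)) (from (meetCond⇔IsGlb iS (glb∈V g)) g)) in
  to (meetCond⇔IsGlb iS (to (∈V⇔InV m _) r∈)) t

record LowerCover (m : ℕ) (y x : List ℕ) : Set where
  field
    cover∈V : InV m y
    below   : y ⊏ x
    tight   : ∀ {z} → InV m z → y ⊏ z → ¬ z ⊏ x

open LowerCover

lowerCovers : ℕ → List ℕ → List (List ℕ)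
lowerCovers m x = filterᵇ (λ y → covBy m y x) (V m)

∈lowerCovers⇔ : ∀ {m x y} → InV m x → y ∈ lowerCovers m x ⇔ LowerCover m y x
∈lowerCovers⇔ {m} {x} {y} ix = mk⇔ to′ from′
  where
  ⊏⇔ : ∀ {a b} → InV m a → InV m b → T (a <V b) ⇔ a ⊏ b
  ⊏⇔ {a} {b} ia ib = <V⇔⊏ a b (sameLength ia ib)
  between : List ℕ → Bool
  between z = (y <V z) ∧ (z <V x)
  to′ : y ∈ lowerCovers m x → LowerCover m y x
  to′ y∈ = let (y∈V , t) = ∈-filterᵇ⁻ _ (V m) y∈ ; (yx , ¬any) = ∧-elim t ; iy = to (∈V⇔InV m y) y∈V in record
    { cover∈V = iy
    ; below = to (⊏⇔ iy ix) yx
    ; tight = λ {z} iz yz zx → not-elim ¬any (any⁺ between (lose (from (∈V⇔InV m z) iz)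
                (∧-intro (from (⊏⇔ iy iz) yz) (from (⊏⇔ iz ix) zx))))
    }
  from′ : LowerCover m y x → y ∈ lowerCovers m x
  from′ c = ∈-filterᵇ⁺ _ (V m) (from (∈V⇔InV m y) (cover∈V c)) (∧-intro (from (⊏⇔ (cover∈V c) ix) (below c))
    (not-intro λ t → let (z , z∈ , tz) = find (any⁻ between (V m) t) ; iz = to (∈V⇔InV m z) z∈ ; (yz , zx) = ∧-elim tz in
       tight c iz (to (⊏⇔ (cover∈V c) iz) yz) (to (⊏⇔ iz ix) zx)))

Pop-isGlb : ∀ {m x} → InV m x → IsGlb m (x ∷ lowerCovers m x) (Pop m x)
Pop-isGlb {m} {x} ix = meet-isGlb inS (⋀-isGlb x (lowerCovers m x) ix inCovers)
  where
  inCovers : ∀ {y} → y ∈ lowerCovers m x → InV m y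
  inCovers = cover∈V ∘ to (∈lowerCovers⇔ ix)
  inS : ∀ {s} → s ∈ x ∷ lowerCovers m x → InV m s
  inS (here refl) = ix
  inS (there s∈) = inCovers s∈

InV-Pop : ∀ {m x} → InV m x → InV m (Pop m x)
InV-Pop = glb∈V ∘ Pop-isGlb

InV-Pop^ : ∀ {m} t {x} → InV m x → InV m (Pop^ m t x)
InV-Pop^ zero ix = ix
InV-Pop^ (suc t) ix = InV-Pop (InV-Pop^ t ix)

-- Concatenation and splitting

shift : ℕ → List ℕ → List ℕ
shift k = map (k +_)

unshift : ℕ → List ℕ → List ℕ
unshift k = map (_∸ k)

infixr 5 _++[_]_
_++[_]_ : List ℕ → ℕ → List ℕ → List ℕ
u ++[ k ] w = u ++ shift k w

unshift-shift : ∀ k v → unshift k (shift k v) ≡ v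
unshift-shift k [] = refl
unshift-shift k (y ∷ v) = cong₂ _∷_ (m+n∸m≡n k y) (unshift-shift k v)

shift-unshift : ∀ k v → (∀ {j} → j < length v → k ≤ v ! j) → shift k (unshift k v) ≡ v
shift-unshift k [] _ = refl
shift-unshift k (y ∷ v) k≤ = cong₂ _∷_ (m+[n∸m]≡n (k≤ (s≤s z≤n))) (shift-unshift k v (k≤ ∘ s≤s))

module _ {k l u w} (iu : InV k u) (iw : InV l w) where

  private
    x : List ℕ
    x = u ++[ k ] w

  length-++[] : length x ≡ 2 * (k + l)
  length-++[] = trans (length-++ u) (trans (cong₂ _+_ (length≡ iu) (trans (length-map (k +_) w) (length≡ iw)))
                                           (sym (*-distribˡ-+ 2 k l)))

  ++[]-atˡ : ∀ {i} → i < 2 * k → x ! i ≡ u ! i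
  ++[]-atˡ i< = !-++ˡ u (subst (_ <_) (sym (length≡ iu)) i<)

  ++[]-atʳ : ∀ {j} → j < 2 * l → x ! (2 * k + j) ≡ k + w ! j
  ++[]-atʳ j< = trans (!-++ʳ u _ (length≡ iu)) (!-map (k +_) w (subst (_ <_) (sym (length≡ iw)) j<))

  ++[]-beyond : ∀ {j} → 2 * l ≤ j → x ! (2 * k + j) ≡ 0
  ++[]-beyond j≥ = trans (!-++ʳ u _ (length≡ iu))
    (!-≥length (shift k w) (subst (_≤ _) (sym (trans (length-map (k +_) w) (length≡ iw))) j≥))

  ++[]-at2[k+q] : ∀ {q} → q < l → x ! (2 * (k + q)) ≡ k + w ! (2 * q)
  ++[]-at2[k+q] {q} q<l = trans (cong (x !_) (*-distribˡ-+ 2 k q)) (++[]-atʳ (2*-mono-< q<l))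

  nested-++[] : ∀ {i j} → i < j → j ≤ 2 * (x ! i) + 1 → x ! j ≤ x ! i
  nested-++[] {i} {j} i<j j≤ with cut (2 * k) i
  ... | before i<2k =
    let j≤′ = subst (λ e → j ≤ 2 * e + 1) (++[]-atˡ i<2k) j≤
        j<2k = ≤-<-trans j≤′ (2*+1-mono-< (entry< iu i<2k)) in
    subst₂ _≤_ (sym (++[]-atˡ j<2k)) (sym (++[]-atˡ i<2k)) (nested iu i<j j≤′)
  ... | after i′ with cut (2 * k) j
  ...   | before j<2k = ⊥-elim (<⇒≱ (<-trans i<j j<2k) (m≤m+n (2 * k) i′))
  ...   | after j′ with j′ <? 2 * l
  ...     | no j′≮ = subst (_≤ _) (sym (++[]-beyond (≮⇒≥ j′≮))) z≤n
  ...     | yes j′< =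
    let i′<j′ = +-cancelˡ-< (2 * k) i′ j′ i<j
        i′< = <-trans i′<j′ j′<
        j′≤ = +-cancelˡ-≤ (2 * k) j′ _ (subst (2 * k + j′ ≤_) (2[k+q]+1≡2k+[2q+1] k (w ! i′))
                (subst (λ e → 2 * k + j′ ≤ 2 * e + 1) (++[]-atʳ i′<) j≤)) in
    subst₂ _≤_ (sym (++[]-atʳ j′<)) (sym (++[]-atʳ i′<)) (+-monoʳ-≤ k (nested iw i′<j′ j′≤))

  InV-++[] : InV (k + l) x
  InV-++[] = record
    { length≡ = length-++[]
    ; odd≡ = λ p< → odd′ p< (cut k _)
    ; even≥ = λ p< → even≥′ p< (cut k _)
    ; even< = λ p< → even<′ p< (cut k _)
    ; nested = nested-++[]
    }
    where
    odd′ : ∀ {p} → p < k + l → Cut k p → x ! (2 * p + 1) ≡ p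
    odd′ _ (before p<k) = trans (++[]-atˡ (2*+1-mono-< p<k)) (odd≡ iu p<k)
    odd′ p< (after q) = let q<l = +-cancelˡ-< k q l p< in
      trans (cong (x !_) (2[k+q]+1≡2k+[2q+1] k q)) (trans (++[]-atʳ (2*+1-mono-< q<l)) (cong (k +_) (odd≡ iw q<l)))
    even≥′ : ∀ {p} → p < k + l → Cut k p → p ≤ x ! (2 * p)
    even≥′ _ (before p<k) = subst (_ ≤_) (sym (++[]-atˡ (2*-mono-< p<k))) (even≥ iu p<k)
    even≥′ p< (after q) = subst (k + q ≤_) (sym (++[]-at2[k+q] (+-cancelˡ-< k q l p<))) (+-monoʳ-≤ k (even≥ iw (+-cancelˡ-< k q l p<)))
    even<′ : ∀ {p} → p < k + l → Cut k p → x ! (2 * p) < k + l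
    even<′ _ (before p<k) = subst (_< k + l) (sym (++[]-atˡ (2*-mono-< p<k))) (<-≤-trans (even< iu p<k) (m≤m+n k l))
    even<′ p< (after q) = subst (_< k + l) (sym (++[]-at2[k+q] (+-cancelˡ-< k q l p<))) (+-monoʳ-< k (even< iw (+-cancelˡ-< k q l p<)))

InV-take : ∀ {k l x} → InV (k + l) x → (∀ {i} → i < 2 * k → x ! i < k) → InV k (take (2 * k) x)
InV-take {k} {l} {x} ix small = record
  { length≡ = trans (length-take (2 * k) x) (m≤n⇒m⊓n≡m (subst (2 * k ≤_) (sym (length≡ ix)) (*-monoʳ-≤ 2 (m≤m+n k l))))
  ; odd≡ = λ p<k → trans (!-take (2 * k) x (2*+1-mono-< p<k)) (odd≡ ix (widen p<k))
  ; even≥ = λ {p} p<k → subst (p ≤_) (sym (!-take (2 * k) x (2*-mono-< p<k))) (even≥ ix (widen p<k))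
  ; even< = λ p<k → subst (_< k) (sym (!-take (2 * k) x (2*-mono-< p<k))) (small (2*-mono-< p<k))
  ; nested = nested′
  }
  where
  widen : ∀ {p} → p < k → p < k + l
  widen p<k = <-≤-trans p<k (m≤m+n k l)
  u : List ℕ
  u = take (2 * k) x
  nested′ : ∀ {i j} → i < j → j ≤ 2 * (u ! i) + 1 → u ! j ≤ u ! i
  nested′ {i} {j} i<j j≤ with j <? 2 * k
  ... | no j≮ = subst (_≤ _) (sym (!-≥length u (≤-trans (≤-reflexive (length-take (2 * k) x)) (≤-trans (m⊓n≤m _ _) (≮⇒≥ j≮))))) z≤n
  ... | yes j< =
    let ei = !-take (2 * k) x (<-trans i<j j<) in
    subst₂ _≤_ (sym (!-take (2 * k) x j<)) (sym ei) (nested ix i<j (subst (λ e → j ≤ 2 * e + 1) ei j≤))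

drop-entry≥ : ∀ {k l x} → InV (k + l) x → ∀ {j} → j < 2 * l → k ≤ drop (2 * k) x ! j
drop-entry≥ {k} {l} {x} ix {j} j< = subst (k ≤_) (sym (!-drop (2 * k) x j)) (entry≥′ (even-or-odd j))
  where
  entry≥′ : ∃[ q ] (j ≡ 2 * q ⊎ j ≡ 2 * q + 1) → k ≤ x ! (2 * k + j)
  entry≥′ (q , inj₁ refl) = ≤-trans (m≤m+n k q)
    (entry≥ ix (+-monoʳ-< k (2*-cancel-< {q} j<)) (inj₁ (sym (*-distribˡ-+ 2 k q))))
  entry≥′ (q , inj₂ refl) = ≤-trans (m≤m+n k q)
    (entry≥ ix (+-monoʳ-< k (2*+1-cancel-< {q} j<)) (inj₂ (sym (2[k+q]+1≡2k+[2q+1] k q))))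

InV-unshift-drop : ∀ {k l x} → InV (k + l) x → InV l (unshift k (drop (2 * k) x))
InV-unshift-drop {k} {l} {x} ix = record
  { length≡ = trans (length-map (_∸ k) v) length-v
  ; odd≡ = λ {q} q<l → trans (w!odd q<l) (trans (cong (_∸ k) (odd≡ ix (+-monoʳ-< k q<l))) (m+n∸m≡n k q))
  ; even≥ = λ {q} q<l → subst (q ≤_) (sym (w!even q<l))
              (subst (_≤ x ! (2 * (k + q)) ∸ k) (m+n∸m≡n k q) (∸-monoˡ-≤ k (even≥ ix (+-monoʳ-< k q<l))))
  ; even< = λ {q} q<l → subst (_< l) (sym (w!even q<l)) (subst (_ <_) (m+n∸m≡n k l)
              (∸-monoˡ-< (even< ix (+-monoʳ-< k q<l)) (≤-trans (m≤m+n k q) (even≥ ix (+-monoʳ-< k q<l)))))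
  ; nested = nested′
  }
  where
  v w : List ℕ
  v = drop (2 * k) x
  w = unshift k v
  length-v : length v ≡ 2 * l
  length-v = trans (length-drop (2 * k) x) (trans (cong (_∸ 2 * k) (trans (length≡ ix) (*-distribˡ-+ 2 k l))) (m+n∸m≡n (2 * k) (2 * l)))
  w!≡ : ∀ {j} → j < 2 * l → w ! j ≡ x ! (2 * k + j) ∸ k
  w!≡ j< = trans (!-map (_∸ k) v (subst (_ <_) (sym length-v) j<)) (cong (_∸ k) (!-drop (2 * k) x _))
  w!even : ∀ {q} → q < l → w ! (2 * q) ≡ x ! (2 * (k + q)) ∸ k
  w!even {q} q<l = trans (w!≡ (2*-mono-< q<l)) (cong (λ e → x ! e ∸ k) (sym (*-distribˡ-+ 2 k q)))
  w!odd : ∀ {q} → q < l → w ! (2 * q + 1) ≡ x ! (2 * (k + q) + 1) ∸ k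
  w!odd {q} q<l = trans (w!≡ (2*+1-mono-< q<l)) (cong (λ e → x ! e ∸ k) (sym (2[k+q]+1≡2k+[2q+1] k q)))
  nested′ : ∀ {i j} → i < j → j ≤ 2 * (w ! i) + 1 → w ! j ≤ w ! i
  nested′ {i} {j} i<j j≤ with j <? 2 * l
  ... | no j≮ = subst (_≤ _) (sym (!-≥length w (subst (_≤ j) (sym (trans (length-map (_∸ k) v) length-v)) (≮⇒≥ j≮)))) z≤n
  ... | yes j< =
    let i< = <-trans i<j j<
        k≤xi = subst (k ≤_) (!-drop (2 * k) x i) (drop-entry≥ ix i<)
        j≤′ = subst (λ e → j ≤ 2 * e + 1) (w!≡ i<) j≤
        2k+j≤ = subst (2 * k + j ≤_) (trans (sym (2[k+q]+1≡2k+[2q+1] k _)) (cong (λ e → 2 * e + 1) (m+[n∸m]≡n k≤xi)))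
                  (+-monoʳ-≤ (2 * k) j≤′) in
    subst₂ _≤_ (sym (w!≡ j<)) (sym (w!≡ i<)) (∸-monoˡ-≤ k (nested ix (+-monoʳ-< (2 * k) i<j) 2k+j≤))

record Splitting (k l : ℕ) (x : List ℕ) : Set where
  constructor splitting
  field
    {left right} : List ℕ
    left∈V  : InV k left
    right∈V : InV l right
    split≡  : x ≡ left ++[ k ] right

split : ∀ {k l x} → InV (k + l) x → (∀ {i} → i < 2 * k → x ! i < k) → Splitting k l x
split {k} {l} {x} ix small = splitting (InV-take ix small) (InV-unshift-drop ix) (sym
  (trans (cong (take (2 * k) x ++_) (shift-unshift k (drop (2 * k) x) λ j< → drop-entry≥ ix (subst (_ <_) length-v j<)))
         (take++drop≡id (2 * k) x)))
  where
  length-v : length (drop (2 * k) x) ≡ 2 * l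
  length-v = trans (sym (length-map (_∸ k) (drop (2 * k) x))) (length≡ (InV-unshift-drop {k} {l} ix))

∷-⊑⇔ : ∀ {x y a b} → x ∷ a ⊑ y ∷ b ⇔ (x ≤ y × a ⊑ b)
∷-⊑⇔ = mk⇔ (λ p → at p 0 , pointwise (at p ∘ suc))
             (λ (x≤y , a⊑b) → pointwise λ { zero → x≤y ; (suc i) → at a⊑b i })

shift-⊑⇔ : ∀ k b d → length b ≡ length d → shift k b ⊑ shift k d ⇔ b ⊑ d
shift-⊑⇔ k [] [] _ = mk⇔ (λ _ → ⊑-refl) (λ _ → ⊑-refl)
shift-⊑⇔ k (x ∷ b) (y ∷ d) e = mk⇔
  (λ p → let (x≤y , b⊑d) = to ∷-⊑⇔ p in from ∷-⊑⇔ (+-cancelˡ-≤ k x y x≤y , to (shift-⊑⇔ k b d (suc-injective e)) b⊑d))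
  (λ p → let (x≤y , b⊑d) = to ∷-⊑⇔ p in from ∷-⊑⇔ (+-monoʳ-≤ k x≤y , from (shift-⊑⇔ k b d (suc-injective e)) b⊑d))

++-⊑⇔ : ∀ a b c d → length a ≡ length c → a ++ b ⊑ c ++ d ⇔ (a ⊑ c × b ⊑ d)
++-⊑⇔ a b c d e = mk⇔
  (λ p → pointwise (left p) , pointwise λ j → subst₂ _≤_ (!-++ʳ a j refl) (!-++ʳ c j (sym e)) (at p (length a + j)))
  (λ (a⊑c , b⊑d) → pointwise λ i → both a⊑c b⊑d i (cut (length a) i))
  where
  left : a ++ b ⊑ c ++ d → ∀ i → a ! i ≤ c ! i
  left p i with i <? length a
  ... | yes i< = subst₂ _≤_ (!-++ˡ a i<) (!-++ˡ c (subst (i <_) e i<)) (at p i)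
  ... | no i≮ = subst (_≤ _) (sym (!-≥length a (≮⇒≥ i≮))) z≤n
  both : a ⊑ c → b ⊑ d → ∀ i → Cut (length a) i → (a ++ b) ! i ≤ (c ++ d) ! i
  both a⊑c _ i (before i<) = subst₂ _≤_ (sym (!-++ˡ a i<)) (sym (!-++ˡ c (subst (i <_) e i<))) (at a⊑c i)
  both _ b⊑d _ (after j) = subst₂ _≤_ (sym (!-++ʳ a j refl)) (sym (!-++ʳ c j (sym e))) (at b⊑d j)

++[]-⊑⇔ : ∀ {k l u₁ w₁ u₂ w₂} → InV k u₁ → InV l w₁ → InV k u₂ → InV l w₂ →
          u₁ ++[ k ] w₁ ⊑ u₂ ++[ k ] w₂ ⇔ (u₁ ⊑ u₂ × w₁ ⊑ w₂)
++[]-⊑⇔ {k} {u₁ = u₁} {w₁} {u₂} {w₂} iu₁ iw₁ iu₂ iw₂ = mk⇔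
  (λ p → let (u⊑u , sw⊑sw) = to (++-⊑⇔ u₁ _ u₂ _ (sameLength iu₁ iu₂)) p in u⊑u , to shift⇔ sw⊑sw)
  (λ (u⊑u , w⊑w) → from (++-⊑⇔ u₁ _ u₂ _ (sameLength iu₁ iu₂)) (u⊑u , from shift⇔ w⊑w))
  where
  shift⇔ : shift k w₁ ⊑ shift k w₂ ⇔ w₁ ⊑ w₂
  shift⇔ = shift-⊑⇔ k w₁ w₂ (sameLength iw₁ iw₂)

++[]-⊏ˡ : ∀ {k l u₁ u₂ w} → InV k u₁ → InV k u₂ → InV l w → u₁ ++[ k ] w ⊏ u₂ ++[ k ] w ⇔ u₁ ⊏ u₂
++[]-⊏ˡ iu₁ iu₂ iw = mk⇔
  (λ (p , ¬q) → proj₁ (to (++[]-⊑⇔ iu₁ iw iu₂ iw) p) , λ q → ¬q (from (++[]-⊑⇔ iu₂ iw iu₁ iw) (q , ⊑-refl)))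
  (λ (p , ¬q) → from (++[]-⊑⇔ iu₁ iw iu₂ iw) (p , ⊑-refl) , λ q → ¬q (proj₁ (to (++[]-⊑⇔ iu₂ iw iu₁ iw) q)))

++[]-⊏ʳ : ∀ {k l u w₁ w₂} → InV k u → InV l w₁ → InV l w₂ → u ++[ k ] w₁ ⊏ u ++[ k ] w₂ ⇔ w₁ ⊏ w₂
++[]-⊏ʳ iu iw₁ iw₂ = mk⇔
  (λ (p , ¬q) → proj₂ (to (++[]-⊑⇔ iu iw₁ iu iw₂) p) , λ q → ¬q (from (++[]-⊑⇔ iu iw₂ iu iw₁) (⊑-refl , q)))
  (λ (p , ¬q) → from (++[]-⊑⇔ iu iw₁ iu iw₂) (⊑-refl , p) , λ q → ¬q (proj₂ (to (++[]-⊑⇔ iu iw₂ iu iw₁) q)))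

⊑∧≢⇒⊏ : ∀ {a b} → length a ≡ length b → a ⊑ b → a ≢ b → a ⊏ b
⊑∧≢⇒⊏ e a⊑b a≢b = a⊑b , a≢b ∘ ⊑-antisym e a⊑b

-- The interval below a concatenation is a product

below-split : ∀ {k l u w z} → InV k u → InV (k + l) z → z ⊑ u ++[ k ] w → Splitting k l z
below-split {u = u} iu iz z⊑ = split iz λ i< →
  ≤-<-trans (subst (_ ≤_) (!-++ˡ u (subst (_ <_) (sym (length≡ iu)) i<)) (at z⊑ _)) (entry< iu i<)

module _ {k l u w} (iu : InV k u) (iw : InV l w) where

  private
    x : List ℕ
    x = u ++[ k ] w
    ix : InV (k + l) x
    ix = InV-++[] iu iw

  lowerCover-++[]ˡ : ∀ {a} → LowerCover k a u → LowerCover (k + l) (a ++[ k ] w) x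
  lowerCover-++[]ˡ {a} c = record
    { cover∈V = InV-++[] ia iw
    ; below = from (++[]-⊏ˡ ia iu iw) (below c)
    ; tight = tight′
    }
    where
    ia : InV k a
    ia = cover∈V c
    tight′ : ∀ {z} → InV (k + l) z → a ++[ k ] w ⊏ z → ¬ z ⊏ x
    tight′ iz az zx with below-split iu iz (proj₁ zx)
    ... | splitting iu′ iw′ refl =
      let (_ , w⊑w′) = to (++[]-⊑⇔ ia iw iu′ iw′) (proj₁ az)
          (_ , w′⊑w) = to (++[]-⊑⇔ iu′ iw′ iu iw) (proj₁ zx) in
      case ⊑-antisym (sameLength iw′ iw) w′⊑w w⊑w′ of λ where
        refl → tight c iu′ (to (++[]-⊏ˡ ia iu′ iw) az) (to (++[]-⊏ˡ iu′ iu iw) zx)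

  lowerCover-++[]ʳ : ∀ {b} → LowerCover l b w → LowerCover (k + l) (u ++[ k ] b) x
  lowerCover-++[]ʳ {b} c = record
    { cover∈V = InV-++[] iu ib
    ; below = from (++[]-⊏ʳ iu ib iw) (below c)
    ; tight = tight′
    }
    where
    ib : InV l b
    ib = cover∈V c
    tight′ : ∀ {z} → InV (k + l) z → u ++[ k ] b ⊏ z → ¬ z ⊏ x
    tight′ iz bz zx with below-split iu iz (proj₁ zx)
    ... | splitting iu′ iw′ refl =
      let (u⊑u′ , _) = to (++[]-⊑⇔ iu ib iu′ iw′) (proj₁ bz)
          (u′⊑u , _) = to (++[]-⊑⇔ iu′ iw′ iu iw) (proj₁ zx) in
      case ⊑-antisym (sameLength iu′ iu) u′⊑u u⊑u′ of λ where
        refl → tight c iw′ (to (++[]-⊏ʳ iu ib iw′) bz) (to (++[]-⊏ʳ iu iw′ iw) zx)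

  -- If both blocks of y moved down, u ++[ k ] (right block of y) would lie strictly between.
  lowerCover-++[]⁻ : ∀ {y} → LowerCover (k + l) y x →
    Σ (Splitting k l y) λ s → (LowerCover k (Splitting.left s) u × Splitting.right s ≡ w)
                              ⊎ (Splitting.left s ≡ u × LowerCover l (Splitting.right s) w)
  lowerCover-++[]⁻ c with below-split iu (cover∈V c) (proj₁ (below c))
  ... | s@(splitting {a} {b} ia ib refl) with to (++[]-⊑⇔ ia ib iu iw) (proj₁ (below c)) | ≡-dec _≟_ a u | ≡-dec _≟_ b w
  ...   | _ | yes refl | yes refl = ⊥-elim (proj₂ (below c) ⊑-refl)
  ...   | _ , b⊑w | yes refl | no b≢w = s , inj₂ (refl , record
    { cover∈V = ib
    ; below = b⊏w
    ; tight = λ iz bz zw → tight c (InV-++[] iu iz) (from (++[]-⊏ʳ iu ib iz) bz) (from (++[]-⊏ʳ iu iz iw) zw)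
    })
    where
    b⊏w : b ⊏ w
    b⊏w = ⊑∧≢⇒⊏ (sameLength ib iw) b⊑w b≢w
  ...   | a⊑u , _ | no a≢u | yes refl = s , inj₁ (record
    { cover∈V = ia
    ; below = a⊏u
    ; tight = λ iz az zu → tight c (InV-++[] iz iw) (from (++[]-⊏ˡ ia iz iw) az) (from (++[]-⊏ˡ iz iu iw) zu)
    } , refl)
    where
    a⊏u : a ⊏ u
    a⊏u = ⊑∧≢⇒⊏ (sameLength ia iu) a⊑u a≢u
  ...   | a⊑u , b⊑w | no a≢u | no b≢w = ⊥-elim (tight c (InV-++[] iu ib)
    (from (++[]-⊏ˡ ia iu ib) (⊑∧≢⇒⊏ (sameLength ia iu) a⊑u a≢u))
    (from (++[]-⊏ʳ iu ib iw) (⊑∧≢⇒⊏ (sameLength ib iw) b⊑w b≢w)))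

  Pop-++[] : Pop (k + l) x ≡ Pop k u ++[ k ] Pop l w
  Pop-++[] = ⊑-antisym (sameLength (glb∈V gX) iPUW) Pop⊑ ⊑Pop
    where
    gX : IsGlb (k + l) (x ∷ lowerCovers (k + l) x) (Pop (k + l) x)
    gX = Pop-isGlb ix
    gU : IsGlb k (u ∷ lowerCovers k u) (Pop k u)
    gU = Pop-isGlb iu
    gW : IsGlb l (w ∷ lowerCovers l w) (Pop l w)
    gW = Pop-isGlb iw
    iPUW : InV (k + l) (Pop k u ++[ k ] Pop l w)
    iPUW = InV-++[] (glb∈V gU) (glb∈V gW)
    ⊑Pop : Pop k u ++[ k ] Pop l w ⊑ Pop (k + l) x
    ⊑Pop = greatest gX iPUW λ where
      (here refl) → from (++[]-⊑⇔ (glb∈V gU) (glb∈V gW) iu iw) (lower gU (here refl) , lower gW (here refl))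
      (there y∈) → case lowerCover-++[]⁻ (to (∈lowerCovers⇔ ix) y∈) of λ where
        (splitting ia ib refl , inj₁ (c , refl)) → from (++[]-⊑⇔ (glb∈V gU) (glb∈V gW) ia ib)
          (lower gU (there (from (∈lowerCovers⇔ iu) c)) , lower gW (here refl))
        (splitting ia ib refl , inj₂ (refl , c)) → from (++[]-⊑⇔ (glb∈V gU) (glb∈V gW) ia ib)
          (lower gU (here refl) , lower gW (there (from (∈lowerCovers⇔ iw) c)))
    Pop⊑ : Pop (k + l) x ⊑ Pop k u ++[ k ] Pop l w
    Pop⊑ with below-split iu (glb∈V gX) (lower gX (here refl))
    ... | splitting {p} {q} ip iq P≡ = subst (_⊑ _) (sym P≡)
      (from (++[]-⊑⇔ ip iq (glb∈V gU) (glb∈V gW)) (greatest gU ip lbU , greatest gW iq lbW))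
      where
      P⊑ : ∀ {s} → s ∈ x ∷ lowerCovers (k + l) x → p ++[ k ] q ⊑ s
      P⊑ s∈ = subst (_⊑ _) P≡ (lower gX s∈)
      lbU : ∀ {s} → s ∈ u ∷ lowerCovers k u → p ⊑ s
      lbU (here refl) = proj₁ (to (++[]-⊑⇔ ip iq iu iw) (P⊑ (here refl)))
      lbU (there a∈) = let c = to (∈lowerCovers⇔ iu) a∈ in
        proj₁ (to (++[]-⊑⇔ ip iq (cover∈V c) iw) (P⊑ (there (from (∈lowerCovers⇔ ix) (lowerCover-++[]ˡ c)))))
      lbW : ∀ {s} → s ∈ w ∷ lowerCovers l w → q ⊑ s
      lbW (here refl) = proj₂ (to (++[]-⊑⇔ ip iq iu iw) (P⊑ (here refl)))
      lbW (there b∈) = let c = to (∈lowerCovers⇔ iw) b∈ in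
        proj₂ (to (++[]-⊑⇔ ip iq iu (cover∈V c)) (P⊑ (there (from (∈lowerCovers⇔ ix) (lowerCover-++[]ʳ c)))))

Pop^-++[] : ∀ t {k l u w} → InV k u → InV l w → Pop^ (k + l) t (u ++[ k ] w) ≡ Pop^ k t u ++[ k ] Pop^ l t w
Pop^-++[] zero iu iw = refl
Pop^-++[] (suc t) {k} {l} iu iw = trans (cong (Pop (k + l)) (Pop^-++[] t iu iw)) (Pop-++[] (InV-Pop^ t iu) (InV-Pop^ t iw))

-- The minimum of V m and sortability of concatenations

-- With even≥, this pins x down to the minimum 0 0 1 1 2 2 … of V m.
IsBottom : List ℕ → Set
IsBottom x = ∀ p → x ! (2 * p) ≤ p

bottom : ℕ → List ℕ
bottom zero = []
bottom (suc m) = (0 ∷ 0 ∷ []) ++[ 1 ] bottom m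

InV-bottom : ∀ m → InV m (bottom m)
InV-bottom zero = record { length≡ = refl ; odd≡ = λ () ; even≥ = λ () ; even< = λ () ; nested = λ _ _ → z≤n }
InV-bottom (suc m) = InV-++[] InV-00 (InV-bottom m)
  where
  0! : ∀ j → (0 ∷ 0 ∷ []) ! j ≡ 0
  0! zero = refl
  0! (suc zero) = refl
  0! (suc (suc j)) = refl
  InV-00 : InV 1 (0 ∷ 0 ∷ [])
  InV-00 = record
    { length≡ = refl
    ; odd≡ = λ { (s≤s z≤n) → refl }
    ; even≥ = λ { (s≤s z≤n) → z≤n }
    ; even< = λ { (s≤s z≤n) → s≤s z≤n }
    ; nested = λ {i} {j} _ _ → subst (_≤ _) (sym (0! j)) z≤n
    }

!-shift≤ : ∀ k w j → shift k w ! j ≤ k + w ! j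
!-shift≤ k [] j = z≤n
!-shift≤ k (y ∷ w) zero = ≤-refl
!-shift≤ k (y ∷ w) (suc j) = !-shift≤ k w j

IsBottom-++[]⇔ : ∀ u {k w} → length u ≡ 2 * k → IsBottom (u ++[ k ] w) ⇔ (IsBottom u × IsBottom w)
IsBottom-++[]⇔ u {k} {w} eu = mk⇔ (λ bx → left bx , right bx) (λ (bu , bw) p → both bu bw (cut k p))
  where
  x : List ℕ
  x = u ++[ k ] w
  at2[k+q] : ∀ q → x ! (2 * (k + q)) ≡ shift k w ! (2 * q)
  at2[k+q] q = trans (cong (x !_) (*-distribˡ-+ 2 k q)) (!-++ʳ u (2 * q) eu)
  left : IsBottom x → IsBottom u
  left bx p with p <? k
  ... | yes p<k = subst (_≤ p) (!-++ˡ u (subst (_ <_) (sym eu) (2*-mono-< p<k))) (bx p)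
  ... | no p≮k = subst (_≤ p) (sym (!-≥length u (subst (_≤ _) (sym eu) (*-monoʳ-≤ 2 (≮⇒≥ p≮k))))) z≤n
  right : IsBottom x → IsBottom w
  right bx q with 2 * q <? length w
  ... | yes 2q< = +-cancelˡ-≤ k _ _ (subst (_≤ k + q) (trans (at2[k+q] q) (!-map (k +_) w 2q<)) (bx (k + q)))
  ... | no 2q≮ = subst (_≤ q) (sym (!-≥length w (≮⇒≥ 2q≮))) z≤n
  both : IsBottom u → IsBottom w → ∀ {p} → Cut k p → x ! (2 * p) ≤ p
  both bu _ (before p<k) = subst (_≤ _) (sym (!-++ˡ u (subst (_ <_) (sym eu) (2*-mono-< p<k)))) (bu _)
  both _ bw (after q) = subst (_≤ k + q) (sym (at2[k+q] q)) (≤-trans (!-shift≤ k w (2 * q)) (+-monoʳ-≤ k (bw q)))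

IsBottom-bottom : ∀ m → IsBottom (bottom m)
IsBottom-bottom zero p = z≤n
IsBottom-bottom (suc m) = from (IsBottom-++[]⇔ (0 ∷ 0 ∷ []) refl) (bottom-1 , IsBottom-bottom m)
  where
  bottom-1 : IsBottom (0 ∷ 0 ∷ [])
  bottom-1 zero = z≤n
  bottom-1 (suc p) = subst (_≤ suc p) (sym (!-≥length (0 ∷ 0 ∷ []) (*-monoʳ-≤ 2 (s≤s (z≤n {p}))))) z≤n

isMin⇔IsBottom : ∀ {m x} → InV m x → T (isMin m x) ⇔ IsBottom x
isMin⇔IsBottom {m} {x} ix = mk⇔
  (λ t p → ≤-trans (at (to (≤V⇔⊑ x (bottom m) (sameLength ix (InV-bottom m)))
                          (all-∈⁻ _ (V m) t (from (∈V⇔InV m _) (InV-bottom m)))) (2 * p))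
                   (IsBottom-bottom m p))
  (λ bx → all-∈⁺ _ (V m) λ {s} s∈ → let is = to (∈V⇔InV m s) s∈ in
    from (≤V⇔⊑ x s (sameLength ix is)) (pointwise λ i → below-all bx is (even-or-odd i)))
  where
  below-all : IsBottom x → ∀ {s i} → InV m s → ∃[ p ] (i ≡ 2 * p ⊎ i ≡ 2 * p + 1) → x ! i ≤ s ! i
  below-all bx {s} {i} is (p , i≡) with p <? m
  ... | yes p<m = [ (λ { refl → ≤-trans (bx p) (even≥ is p<m) }) ,
                    (λ { refl → ≤-reflexive (trans (odd≡ ix p<m) (sym (odd≡ is p<m))) }) ]′ i≡
  ... | no p≮m = subst (_≤ s ! i) (sym (!-beyond ix (≤-trans (*-monoʳ-≤ 2 (≮⇒≥ p≮m))
                   ([ (λ { refl → ≤-refl }) , (λ { refl → m≤m+n (2 * p) 1 }) ]′ i≡)))) z≤n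

isMin-++[]⇔ : ∀ {k l u w} → InV k u → InV l w →
              T (isMin (k + l) (u ++[ k ] w)) ⇔ (T (isMin k u) × T (isMin l w))
isMin-++[]⇔ {k} {l} {u} {w} iu iw = mk⇔
  (λ t → let (bu , bw) = to bottom⇔ (to (isMin⇔IsBottom ix) t) in from (isMin⇔IsBottom iu) bu , from (isMin⇔IsBottom iw) bw)
  (λ (tu , tw) → from (isMin⇔IsBottom ix) (from bottom⇔ (to (isMin⇔IsBottom iu) tu , to (isMin⇔IsBottom iw) tw)))
  where
  ix : InV (k + l) (u ++[ k ] w)
  ix = InV-++[] iu iw
  bottom⇔ : IsBottom (u ++[ k ] w) ⇔ (IsBottom u × IsBottom w)
  bottom⇔ = IsBottom-++[]⇔ u (length≡ iu)

sortable-++[]⇔ : ∀ t {k l u w} → InV k u → InV l w →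
                 T (sortable (k + l) t (u ++[ k ] w)) ⇔ (T (sortable k t u) × T (sortable l t w))
sortable-++[]⇔ t {k} {l} {u} {w} iu iw =
  subst (λ e → T (isMin (k + l) e) ⇔ (T (sortable k t u) × T (sortable l t w))) (sym (Pop^-++[] t iu iw))
  (isMin-++[]⇔ (InV-Pop^ t iu) (InV-Pop^ t iw))

𝟙 : Bool → ℕ
𝟙 true = 1
𝟙 false = 0

𝟙-∧ : ∀ a b → 𝟙 (a ∧ b) ≡ 𝟙 a * 𝟙 b
𝟙-∧ true true = refl
𝟙-∧ true false = refl
𝟙-∧ false b = refl

𝟙-cong : ∀ {a b} → T a ⇔ T b → 𝟙 a ≡ 𝟙 b
𝟙-cong {false} {false} _ = refl
𝟙-cong {false} {true} a⇔b = ⊥-elim (from a⇔b _)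
𝟙-cong {true} {false} a⇔b = ⊥-elim (to a⇔b _)
𝟙-cong {true} {true} _ = refl

∑ : ∀ {A : Set} → List A → (A → ℕ) → ℕ
∑ [] f = 0
∑ (x ∷ xs) f = f x + ∑ xs f

∑< : ℕ → (ℕ → ℕ) → ℕ
∑< zero f = 0
∑< (suc n) f = f 0 + ∑< n (f ∘ suc)

module _ {A : Set} where

  length-filterᵇ² : ∀ (p q : A → Bool) xs → length (filterᵇ q (filterᵇ p xs)) ≡ ∑ xs (λ x → 𝟙 (p x ∧ q x))
  length-filterᵇ² p q [] = refl
  length-filterᵇ² p q (x ∷ xs) with p x
  ... | false = length-filterᵇ² p q xs
  ... | true with q x
  ...   | true = cong suc (length-filterᵇ² p q xs)
  ...   | false = length-filterᵇ² p q xs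

  ∑-cong : ∀ xs {f g : A → ℕ} → (∀ {x} → x ∈ xs → f x ≡ g x) → ∑ xs f ≡ ∑ xs g
  ∑-cong [] _ = refl
  ∑-cong (x ∷ xs) f≡g = cong₂ _+_ (f≡g (here refl)) (∑-cong xs (f≡g ∘ there))

  ∑-zero : ∀ (xs : List A) → ∑ xs (λ _ → 0) ≡ 0
  ∑-zero [] = refl
  ∑-zero (x ∷ xs) = ∑-zero xs

  ∑-++ : ∀ xs ys (f : A → ℕ) → ∑ (xs ++ ys) f ≡ ∑ xs f + ∑ ys f
  ∑-++ [] ys f = refl
  ∑-++ (x ∷ xs) ys f = trans (cong (f x +_) (∑-++ xs ys f)) (sym (+-assoc (f x) _ _))

  ∑-+ : ∀ xs (f g : A → ℕ) → ∑ xs (λ x → f x + g x) ≡ ∑ xs f + ∑ xs g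
  ∑-+ [] f g = refl
  ∑-+ (x ∷ xs) f g rewrite ∑-+ xs f g = +-interchange (f x) (g x) (∑ xs f) (∑ xs g)
    where +-interchange : ∀ a b c d → a + b + (c + d) ≡ a + c + (b + d)
          +-interchange = solve-∀

  ∑-*ʳ : ∀ xs (f : A → ℕ) c → ∑ xs (λ x → f x * c) ≡ ∑ xs f * c
  ∑-*ʳ [] f c = refl
  ∑-*ʳ (x ∷ xs) f c = trans (cong (f x * c +_) (∑-*ʳ xs f c)) (sym (*-distribʳ-+ c (f x) _))

  ∑-*ˡ : ∀ xs (f : A → ℕ) c → ∑ xs (λ x → c * f x) ≡ c * ∑ xs f
  ∑-*ˡ [] f c = sym (*-zeroʳ c)
  ∑-*ˡ (x ∷ xs) f c = trans (cong (c * f x +_) (∑-*ˡ xs f c)) (sym (*-distribˡ-+ c (f x) _))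

  ∑-∑<-comm : ∀ xs n (F : A → ℕ → ℕ) → ∑ xs (λ x → ∑< n (F x)) ≡ ∑< n (λ c → ∑ xs (λ x → F x c))
  ∑-∑<-comm xs zero F = ∑-zero xs
  ∑-∑<-comm xs (suc n) F = trans (∑-+ xs (λ x → F x 0) (λ x → ∑< n (F x ∘ suc)))
                                 (cong (∑ xs (λ x → F x 0) +_) (∑-∑<-comm xs n (λ x → F x ∘ suc)))

∑-map : ∀ {A B : Set} (g : A → B) xs f → ∑ (map g xs) f ≡ ∑ xs (f ∘ g)
∑-map g [] f = refl
∑-map g (x ∷ xs) f = cong (f (g x) +_) (∑-map g xs f)

∑-concatMap : ∀ {A B : Set} (g : A → List B) xs f → ∑ (concatMap g xs) f ≡ ∑ xs (λ x → ∑ (g x) f)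
∑-concatMap g [] f = refl
∑-concatMap g (x ∷ xs) f = trans (∑-++ (g x) _ f) (cong (∑ (g x) f +_) (∑-concatMap g xs f))

∑-applyUpTo : ∀ (g : ℕ → ℕ) n f → ∑ (applyUpTo g n) f ≡ ∑< n (f ∘ g)
∑-applyUpTo g zero f = refl
∑-applyUpTo g (suc n) f = cong (f (g 0) +_) (∑-applyUpTo (g ∘ suc) n f)

∑<-cong : ∀ n {f g : ℕ → ℕ} → (∀ {c} → c < n → f c ≡ g c) → ∑< n f ≡ ∑< n g
∑<-cong zero _ = refl
∑<-cong (suc n) f≡g = cong₂ _+_ (f≡g (s≤s z≤n)) (∑<-cong n (f≡g ∘ s≤s))

∑<-zero : ∀ n {f : ℕ → ℕ} → (∀ {c} → c < n → f c ≡ 0) → ∑< n f ≡ 0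
∑<-zero zero _ = refl
∑<-zero (suc n) {f} f≡0 = trans (cong (_+ ∑< n (f ∘ suc)) (f≡0 (s≤s z≤n))) (∑<-zero n (f≡0 ∘ s≤s))

∑<-+ : ∀ a b f → ∑< (a + b) f ≡ ∑< a f + ∑< b (λ c → f (a + c))
∑<-+ zero b f = refl
∑<-+ (suc a) b f = trans (cong (f 0 +_) (∑<-+ a b (f ∘ suc))) (sym (+-assoc (f 0) _ _))

∑<-suc : ∀ n f → ∑< (suc n) f ≡ ∑< n f + f n
∑<-suc n f = trans (cong (λ m → ∑< m f) (+-comm 1 n))
  (trans (∑<-+ n 1 f) (cong (∑< n f +_) (trans (+-identityʳ _) (cong f (+-identityʳ n)))))

∑<-reverse : ∀ n f → ∑< n f ≡ ∑< n (λ c → f (n ∸ suc c))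
∑<-reverse zero f = refl
∑<-reverse (suc n) f = begin
    f 0 + ∑< n (f ∘ suc)                    ≡⟨ cong (f 0 +_) (∑<-reverse n (f ∘ suc)) ⟩
    f 0 + ∑< n (λ c → f (suc (n ∸ suc c)))  ≡⟨ cong (f 0 +_) (∑<-cong n (λ c< → cong f (sym (+-∸-assoc 1 c<)))) ⟩
    f 0 + ∑< n (λ c → f (n ∸ c))            ≡⟨ +-comm (f 0) _ ⟩
    ∑< n (λ c → f (n ∸ c)) + f 0            ≡⟨ cong (λ e → ∑< n (λ c → f (n ∸ c)) + f e) (n∸n≡0 n) ⟨
    ∑< n (λ c → f (n ∸ c)) + f (n ∸ n)      ≡⟨ ∑<-suc n (λ c → f (n ∸ c)) ⟨
    ∑< (suc n) (λ c → f (n ∸ c))            ∎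
  where open ≡-Reasoning

∑<-window : ∀ k r R f → k + r ≤ R → (∀ c → ¬ (k ≤ c × c < k + r) → f c ≡ 0) → ∑< R f ≡ ∑< r (λ c → f (k + c))
∑<-window k r R f k+r≤R outside≡0 with m≤n⇒∃[o]m+o≡n k+r≤R
... | e , refl = begin
    ∑< (k + r + e) f                                                  ≡⟨ cong (λ m → ∑< m f) (+-assoc k r e) ⟩
    ∑< (k + (r + e)) f                                                ≡⟨ ∑<-+ k (r + e) f ⟩
    ∑< k f + ∑< (r + e) (λ c → f (k + c))                             ≡⟨ cong₂ _+_ before≡0 (∑<-+ r e (λ c → f (k + c))) ⟩
    0 + (∑< r (λ c → f (k + c)) + ∑< e (λ c → f (k + (r + c))))       ≡⟨ cong (∑< r (λ c → f (k + c)) +_) after≡0 ⟩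
    ∑< r (λ c → f (k + c)) + 0                                        ≡⟨ +-identityʳ _ ⟩
    ∑< r (λ c → f (k + c))                                            ∎
  where
  open ≡-Reasoning
  before≡0 : ∑< k f ≡ 0
  before≡0 = ∑<-zero k λ c<k → outside≡0 _ λ (k≤c , _) → <⇒≱ c<k k≤c
  after≡0 : ∑< e (λ c → f (k + (r + c))) ≡ 0
  after≡0 = ∑<-zero e λ {c} _ → outside≡0 _ λ (_ , lt) → <⇒≱ lt (+-monoʳ-≤ k (m≤m+n r c))

∑-allLists-suc : ∀ l r F → ∑ (allLists (suc l) r) F ≡ ∑ (allLists l r) (λ v → ∑< r (λ c → F (c ∷ v)))
∑-allLists-suc l r F = trans (∑-concatMap (λ v → map (_∷ v) (upTo r)) (allLists l r) F)
  (∑-cong (allLists l r) λ {v} _ → trans (∑-map (_∷ v) (upTo r) F) (∑-applyUpTo id r (F ∘ (_∷ v))))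

∑-allLists-cong : ∀ l r {F G : List ℕ → ℕ} → (∀ x → length x ≡ l → F x ≡ G x) → ∑ (allLists l r) F ≡ ∑ (allLists l r) G
∑-allLists-cong zero r F≡G = cong (_+ 0) (F≡G [] refl)
∑-allLists-cong (suc l) r {F} {G} F≡G = begin
  ∑ (allLists (suc l) r) F                          ≡⟨ ∑-allLists-suc l r F ⟩
  ∑ (allLists l r) (λ v → ∑< r (λ c → F (c ∷ v)))  ≡⟨ ∑-allLists-cong l r (λ v ev → ∑<-cong r λ _ → F≡G _ (cong suc ev)) ⟩
  ∑ (allLists l r) (λ v → ∑< r (λ c → G (c ∷ v)))  ≡⟨ ∑-allLists-suc l r G ⟨
  ∑ (allLists (suc l) r) G                          ∎
  where open ≡-Reasoning

∑-allLists-++ : ∀ l₁ l₂ r F → ∑ (allLists (l₁ + l₂) r) F ≡ ∑ (allLists l₂ r) (λ w → ∑ (allLists l₁ r) (λ u → F (u ++ w)))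
∑-allLists-++ zero l₂ r F = ∑-cong (allLists l₂ r) λ {w} _ → sym (+-identityʳ (F w))
∑-allLists-++ (suc l₁) l₂ r F = begin
  ∑ (allLists (suc (l₁ + l₂)) r) F                                              ≡⟨ ∑-allLists-suc (l₁ + l₂) r F ⟩
  ∑ (allLists (l₁ + l₂) r) (λ v → ∑< r (λ c → F (c ∷ v)))                       ≡⟨ ∑-allLists-++ l₁ l₂ r _ ⟩
  ∑ (allLists l₂ r) (λ w → ∑ (allLists l₁ r) (λ u → ∑< r (λ c → F (c ∷ u ++ w))))
    ≡⟨ ∑-cong (allLists l₂ r) (λ {w} _ → ∑-allLists-suc l₁ r (λ u → F (u ++ w))) ⟨
  ∑ (allLists l₂ r) (λ w → ∑ (allLists (suc l₁) r) (λ u → F (u ++ w)))          ∎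
  where open ≡-Reasoning

InRange : ℕ → ℕ → List ℕ → Set
InRange k r w = ∀ {j} → j < length w → k ≤ w ! j × w ! j < k + r

∑-allLists-shift : ∀ l k r R F → k + r ≤ R → (∀ w → ¬ InRange k r w → F w ≡ 0) →
                   ∑ (allLists l R) F ≡ ∑ (allLists l r) (F ∘ shift k)
∑-allLists-shift zero k r R F _ _ = refl
∑-allLists-shift (suc l) k r R F k+r≤R outside≡0 = begin
  ∑ (allLists (suc l) R) F                                     ≡⟨ ∑-allLists-suc l R F ⟩
  ∑ (allLists l R) (λ v → ∑< R (λ c → F (c ∷ v)))             ≡⟨ ∑-allLists-shift l k r R _ k+r≤R tail-outside ⟩
  ∑ (allLists l r) (λ v → ∑< R (λ c → F (c ∷ shift k v)))     ≡⟨ ∑-cong (allLists l r) (λ _ → ∑<-window k r R _ k+r≤R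
                                                                    λ c c∉ → outside≡0 _ λ inR → c∉ (inR (s≤s z≤n))) ⟩
  ∑ (allLists l r) (λ v → ∑< r (λ c → F (k + c ∷ shift k v))) ≡⟨ ∑-allLists-suc l r (F ∘ shift k) ⟨
  ∑ (allLists (suc l) r) (F ∘ shift k)                         ∎
  where
  open ≡-Reasoning
  tail-outside : ∀ v → ¬ InRange k r v → ∑< R (λ c → F (c ∷ v)) ≡ 0
  tail-outside v v∉ = ∑<-zero R λ _ → outside≡0 _ λ inR → v∉ (inR ∘ s≤s)

-- Splitting off the first irreducible block

sortableIn : ℕ → ℕ → List ℕ → Bool
sortableIn n t x = isV n x ∧ sortable n t x

irreducibleSortableIn : ℕ → ℕ → List ℕ → Bool
irreducibleSortableIn n t x = isV n x ∧ (sortable n t x ∧ irreducible n x)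

sortableStartingWith : ℕ → ℕ → ℕ → List ℕ → Bool
sortableStartingWith c n t x = isV n x ∧ ((x ! 0 ≡ᵇ c) ∧ sortable n t x)

shiftedSortableIn : ℕ → ℕ → ℕ → List ℕ → Bool
shiftedSortableIn k l t v = ⌊ ≡-dec _≟_ v (shift k (unshift k v)) ⌋ ∧ sortableIn l t (unshift k v)

h≡∑ : ∀ t n → h t n ≡ ∑ (allLists (2 * n) n) (𝟙 ∘ sortableIn n t)
h≡∑ t n = length-filterᵇ² (isV n) (sortable n t) (allLists (2 * n) n)

g≡∑ : ∀ t n → g t n ≡ ∑ (allLists (2 * n) n) (𝟙 ∘ irreducibleSortableIn n t)
g≡∑ t n = length-filterᵇ² (isV n) (λ x → sortable n t x ∧ irreducible n x) (allLists (2 * n) n)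

firstEntry-bounds : ∀ {n c x} → InV n x → x ! 0 ≡ c → ∀ {i} → i < 2 * suc c → x ! i < suc c
firstEntry-bounds ix x0≡c {zero} _ = s≤s (≤-reflexive x0≡c)
firstEntry-bounds {c = c} {x} ix x0≡c {suc i} i< = s≤s (subst (x ! suc i ≤_) x0≡c
  (nested ix (s≤s z≤n) (subst (λ e → suc i ≤ 2 * e + 1) (sym x0≡c) (≤-pred (subst (suc i <_) (sym (suc[2p+1]≡2[1+p] c)) i<)))))

irreducible⇔ : ∀ {c u} → InV (suc c) u → T (irreducible (suc c) u) ⇔ u ! 0 ≡ c
irreducible⇔ {c} {u} iu = mk⇔
  (λ t → trans (≡ᵇ⇒≡ _ _ t) last≡c)
  (λ u0≡c → ≡⇒≡ᵇ _ _ (trans u0≡c (sym last≡c)))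
  where
  last≡c : u ! (2 * suc c ∸ 1) ≡ c
  last≡c = trans (cong (λ e → u ! (e ∸ 1)) (sym (suc[2p+1]≡2[1+p] c))) (odd≡ iu ≤-refl)

++-injective : ∀ {a b c d : List ℕ} → length a ≡ length c → a ++ b ≡ c ++ d → a ≡ c × b ≡ d
++-injective {[]} {c = []} _ e = refl , e
++-injective {x ∷ a} {c = y ∷ c} ea e =
  let (a≡c , b≡d) = ++-injective (suc-injective ea) (∷-injectiveʳ e) in cong₂ _∷_ (∷-injectiveˡ e) a≡c , b≡d

sortableStartingWith⇔ : ∀ c n t x → T (sortableStartingWith c n t x) ⇔ (InV n x × x ! 0 ≡ c × T (sortable n t x))
sortableStartingWith⇔ c n t x = mk⇔
  (λ s → let (isVx , s′) = ∧-elim {isV n x} s ; (x0≡c , sx) = ∧-elim {x ! 0 ≡ᵇ c} s′ in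
         to (isV⇔InV n x) isVx , ≡ᵇ⇒≡ _ _ x0≡c , sx)
  (λ (ix , x0≡c , sx) → ∧-intro (from (isV⇔InV n x) ix) (∧-intro (≡⇒≡ᵇ _ _ x0≡c) sx))

irreducibleSortableIn⇔ : ∀ c t u → T (irreducibleSortableIn (suc c) t u) ⇔ (InV (suc c) u × T (sortable (suc c) t u) × u ! 0 ≡ c)
irreducibleSortableIn⇔ c t u = mk⇔
  (λ s → let (isVu , s′) = ∧-elim {isV (suc c) u} s ; (su , irr) = ∧-elim {sortable (suc c) t u} s′
             iu = to (isV⇔InV (suc c) u) isVu in
         iu , su , to (irreducible⇔ iu) irr)
  (λ (iu , su , u0≡c) → ∧-intro (from (isV⇔InV (suc c) u) iu) (∧-intro su (from (irreducible⇔ iu) u0≡c)))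

shiftedSortableIn⇔ : ∀ k l t v → T (shiftedSortableIn k l t v) ⇔ (∃[ w ] (v ≡ shift k w × InV l w × T (sortable l t w)))
shiftedSortableIn⇔ k l t v = mk⇔
  (λ s → let (v≡ , s′) = ∧-elim {⌊ ≡-dec _≟_ v (shift k (unshift k v)) ⌋} s ; (isVw , sw) = ∧-elim {isV l (unshift k v)} s′ in
         unshift k v , toWitness v≡ , to (isV⇔InV l _) isVw , sw)
  (λ { (w , refl , iw , sw) → ∧-intro {⌊ ≡-dec _≟_ (shift k w) (shift k (unshift k (shift k w))) ⌋}
         (fromWitness (cong (shift k) (sym (unshift-shift k w))))
         (subst (T ∘ sortableIn l t) (sym (unshift-shift k w)) (∧-intro (from (isV⇔InV l w) iw) sw)) })

sortableStartingWith-++⇔ : ∀ t c l u v → length u ≡ 2 * suc c →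
  T (sortableStartingWith c (suc c + l) t (u ++ v)) ⇔ T (irreducibleSortableIn (suc c) t u ∧ shiftedSortableIn (suc c) l t v)
sortableStartingWith-++⇔ t c l u v eu = mk⇔ to′ from′
  where
  k : ℕ
  k = suc c
  x0≡u0 : (u ++ v) ! 0 ≡ u ! 0
  x0≡u0 = !-++ˡ u (subst (0 <_) (sym eu) (s≤s z≤n))
  to′ : T (sortableStartingWith c (k + l) t (u ++ v)) → T (irreducibleSortableIn k t u ∧ shiftedSortableIn k l t v)
  to′ s with to (sortableStartingWith⇔ c (k + l) t (u ++ v)) s
  ... | ix , x0≡c , sx with split {k} {l} ix (firstEntry-bounds ix x0≡c)
  ...   | splitting {u′} {w} iu iw x≡ with ++-injective {u} {v} {u′} {shift k w} (trans eu (sym (length≡ iu))) x≡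
  ...     | refl , refl = let (su , sw) = to (sortable-++[]⇔ t iu iw) sx in
    ∧-intro (from (irreducibleSortableIn⇔ c t u) (iu , su , trans (sym x0≡u0) x0≡c))
            (from (shiftedSortableIn⇔ k l t v) (w , refl , iw , sw))
  from′ : T (irreducibleSortableIn k t u ∧ shiftedSortableIn k l t v) → T (sortableStartingWith c (k + l) t (u ++ v))
  from′ s with ∧-elim {irreducibleSortableIn k t u} s
  ... | tu , tv with to (irreducibleSortableIn⇔ c t u) tu | to (shiftedSortableIn⇔ k l t v) tv
  ...   | iu , su , u0≡c | w , refl , iw , sw =
    from (sortableStartingWith⇔ c (k + l) t (u ++ v)) (InV-++[] iu iw , trans x0≡u0 u0≡c , from (sortable-++[]⇔ t iu iw) (su , sw))

InRange-shift : ∀ k {l w} → InV l w → InRange k l (shift k w)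
InRange-shift k {l} {w} iw j< =
  let j<w = subst (_ <_) (length-map (k +_) w) j< ; e = !-map (k +_) w j<w in
  subst (k ≤_) (sym e) (m≤m+n k _) , subst (_< k + l) (sym e) (+-monoʳ-< k (entry< iw (subst (_ <_) (length≡ iw) j<w)))

∑-irreducibleSortableIn : ∀ t k l → ∑ (allLists (2 * k) (k + l)) (𝟙 ∘ irreducibleSortableIn k t) ≡ g t k
∑-irreducibleSortableIn t k l = begin
  ∑ (allLists (2 * k) (k + l)) (𝟙 ∘ irreducibleSortableIn k t)
    ≡⟨ ∑-allLists-shift (2 * k) 0 k (k + l) _ (m≤m+n k l) outside≡0 ⟩
  ∑ (allLists (2 * k) k) (𝟙 ∘ irreducibleSortableIn k t ∘ shift 0)
    ≡⟨ ∑-cong (allLists (2 * k) k) (λ {u} _ → cong (𝟙 ∘ irreducibleSortableIn k t) (map-id u)) ⟩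
  ∑ (allLists (2 * k) k) (𝟙 ∘ irreducibleSortableIn k t)
    ≡⟨ g≡∑ t k ⟨
  g t k                                                                  ∎
  where
  open ≡-Reasoning
  outside≡0 : ∀ u → ¬ InRange 0 k u → 𝟙 (irreducibleSortableIn k t u) ≡ 0
  outside≡0 u u∉ with isV k u in isVu
  ... | false = refl
  ... | true = ⊥-elim (u∉ λ j< → z≤n , entry< iu (subst (_ <_) (length≡ iu) j<))
    where
    iu : InV k u
    iu = to (isV⇔InV k u) (subst T (sym isVu) _)

∑-shiftedSortableIn : ∀ t k l → ∑ (allLists (2 * l) (k + l)) (𝟙 ∘ shiftedSortableIn k l t) ≡ h t l
∑-shiftedSortableIn t k l = begin
  ∑ (allLists (2 * l) (k + l)) (𝟙 ∘ shiftedSortableIn k l t)       ≡⟨ ∑-allLists-shift (2 * l) k l (k + l) _ ≤-refl outside≡0 ⟩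
  ∑ (allLists (2 * l) l) (𝟙 ∘ shiftedSortableIn k l t ∘ shift k)   ≡⟨ ∑-cong (allLists (2 * l) l) (λ {w} _ → shifted w) ⟩
  ∑ (allLists (2 * l) l) (𝟙 ∘ sortableIn l t)                      ≡⟨ h≡∑ t l ⟨
  h t l                                                            ∎
  where
  open ≡-Reasoning
  outside≡0 : ∀ v → ¬ InRange k l v → 𝟙 (shiftedSortableIn k l t v) ≡ 0
  outside≡0 v v∉ with shiftedSortableIn k l t v in sv
  ... | false = refl
  ... | true with to (shiftedSortableIn⇔ k l t v) (subst T (sym sv) _)
  ...   | w , refl , iw , _ = ⊥-elim (v∉ (InRange-shift k iw))
  shifted : ∀ w → 𝟙 (shiftedSortableIn k l t (shift k w)) ≡ 𝟙 (sortableIn l t w)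
  shifted w rewrite unshift-shift k w with ≡-dec _≟_ (shift k w) (shift k w)
  ... | yes _ = refl
  ... | no ≢ = ⊥-elim (≢ refl)

∑-sortableStartingWith : ∀ t c l →
  ∑ (allLists (2 * (suc c + l)) (suc c + l)) (𝟙 ∘ sortableStartingWith c (suc c + l) t) ≡ g t (suc c) * h t l
∑-sortableStartingWith t c l = begin
  ∑ (allLists (2 * n) n) F                                       ≡⟨ cong (λ m → ∑ (allLists m n) F) (*-distribˡ-+ 2 k l) ⟩
  ∑ (allLists (2 * k + 2 * l) n) F                               ≡⟨ ∑-allLists-++ (2 * k) (2 * l) n F ⟩
  ∑ (allLists (2 * l) n) (λ v → ∑ (allLists (2 * k) n) (λ u → F (u ++ v)))
                                                                 ≡⟨ ∑-cong (allLists (2 * l) n) (λ _ → ∑-allLists-cong (2 * k) n factor) ⟩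
  ∑ (allLists (2 * l) n) (λ v → ∑ (allLists (2 * k) n) (λ u → A u * B v))
                                                                 ≡⟨ ∑-cong (allLists (2 * l) n) (λ {v} _ → ∑-*ʳ (allLists (2 * k) n) A (B v)) ⟩
  ∑ (allLists (2 * l) n) (λ v → ∑ (allLists (2 * k) n) A * B v)  ≡⟨ ∑-*ˡ (allLists (2 * l) n) B (∑ (allLists (2 * k) n) A) ⟩
  ∑ (allLists (2 * k) n) A * ∑ (allLists (2 * l) n) B            ≡⟨ cong₂ _*_ (∑-irreducibleSortableIn t k l) (∑-shiftedSortableIn t k l) ⟩
  g t k * h t l                                                  ∎
  where
  open ≡-Reasoning
  k n : ℕ
  k = suc c
  n = k + l
  F A B : List ℕ → ℕ
  F = 𝟙 ∘ sortableStartingWith c n t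
  A = 𝟙 ∘ irreducibleSortableIn k t
  B = 𝟙 ∘ shiftedSortableIn k l t
  factor : ∀ {v} u → length u ≡ 2 * k → F (u ++ v) ≡ A u * B v
  factor {v} u eu = trans (𝟙-cong (sortableStartingWith-++⇔ t c l u v eu)) (𝟙-∧ (irreducibleSortableIn k t u) (shiftedSortableIn k l t v))

∑<-𝟙-≡ᵇ : ∀ n {a} s → a < n → ∑< n (λ c → 𝟙 ((a ≡ᵇ c) ∧ s)) ≡ 𝟙 s
∑<-𝟙-≡ᵇ (suc n) {zero} s _ = trans (cong (𝟙 s +_) (∑<-zero n λ _ → refl)) (+-identityʳ (𝟙 s))
∑<-𝟙-≡ᵇ (suc n) {suc a} s (s≤s a<n) = ∑<-𝟙-≡ᵇ n s a<n

h-suc : ∀ t m → h t (suc m) ≡ ∑< (suc m) (λ c → g t (suc c) * h t (m ∸ c))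
h-suc t m = begin
  h t n                                                        ≡⟨ h≡∑ t n ⟩
  ∑ (allLists (2 * n) n) (𝟙 ∘ sortableIn n t)                  ≡⟨ ∑-cong (allLists (2 * n) n) (λ {x} _ → byFirstEntry x) ⟩
  ∑ (allLists (2 * n) n) (λ x → ∑< n (λ c → F c x))            ≡⟨ ∑-∑<-comm (allLists (2 * n) n) n (λ x c → F c x) ⟩
  ∑< n (λ c → ∑ (allLists (2 * n) n) (F c))                    ≡⟨ ∑<-cong n block ⟩
  ∑< n (λ c → g t (suc c) * h t (m ∸ c))                       ∎
  where
  open ≡-Reasoning
  n : ℕ
  n = suc m
  F : ℕ → List ℕ → ℕ
  F c = 𝟙 ∘ sortableStartingWith c n t
  byFirstEntry : ∀ x → 𝟙 (sortableIn n t x) ≡ ∑< n (λ c → F c x)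
  byFirstEntry x with isV n x in isVx
  ... | false = sym (∑<-zero n λ _ → refl)
  ... | true = sym (∑<-𝟙-≡ᵇ n (sortable n t x) (entry< (to (isV⇔InV n x) (subst T (sym isVx) _)) (s≤s z≤n)))
  block : ∀ {c} → c < n → ∑ (allLists (2 * n) n) (F c) ≡ g t (suc c) * h t (m ∸ c)
  block {c} (s≤s c≤m) = subst (λ e → ∑ (allLists (2 * e) e) (𝟙 ∘ sortableStartingWith c e t) ≡ g t (suc c) * h t (m ∸ c))
    (cong suc (m+[n∸m]≡n c≤m)) (∑-sortableStartingWith t c (m ∸ c))

h-convolution : ∀ t m → h t (suc m) ≡ ∑< (suc m) (λ c → h t c * g t (suc m ∸ c))
h-convolution t m = begin
  h t (suc m)                                                ≡⟨ h-suc t m ⟩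
  ∑< (suc m) (λ c → g t (suc c) * h t (m ∸ c))               ≡⟨ ∑<-reverse (suc m) (λ c → g t (suc c) * h t (m ∸ c)) ⟩
  ∑< (suc m) (λ c → g t (suc (m ∸ c)) * h t (m ∸ (m ∸ c)))   ≡⟨ ∑<-cong (suc m) (swap ∘ ≤-pred) ⟩
  ∑< (suc m) (λ c → h t c * g t (suc m ∸ c))                 ∎
  where
  open ≡-Reasoning
  swap : ∀ {c} → c ≤ m → g t (suc (m ∸ c)) * h t (m ∸ (m ∸ c)) ≡ h t c * g t (suc m ∸ c)
  swap {c} c≤m = trans (*-comm (g t (suc (m ∸ c))) _)
    (cong₂ (λ a b → h t a * g t b) (m∸[m∸n]≡n c≤m) (sym (+-∸-assoc 1 c≤m)))

h-zero : ∀ t → h t 0 ≡ 1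
h-zero t with Pop^ 0 t [] | InV-Pop^ {0} t {[]} (InV-bottom 0)
... | [] | _ = refl
... | _ ∷ _ | ()

∑ℤ< : ℕ → (ℕ → ℤ) → ℤ
∑ℤ< zero f = ⁺ 0
∑ℤ< (suc n) f = f 0 ℤ.+ ∑ℤ< n (f ∘ suc)

sumUpTo≡∑ℤ< : ∀ n f → sumUpTo n f ≡ ∑ℤ< (suc n) f
sumUpTo≡∑ℤ< n f = go id (suc n)
  where
  go : ∀ (g : ℕ → ℕ) m → foldr ℤ._+_ (⁺ 0) (map f (applyUpTo g m)) ≡ ∑ℤ< m (f ∘ g)
  go g zero = refl
  go g (suc m) = cong (λ s → f (g 0) ℤ.+ s) (go (g ∘ suc) m)

∑ℤ<-cong : ∀ n {f g : ℕ → ℤ} → (∀ {c} → c < n → f c ≡ g c) → ∑ℤ< n f ≡ ∑ℤ< n g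
∑ℤ<-cong zero _ = refl
∑ℤ<-cong (suc n) f≡g = cong₂ ℤ._+_ (f≡g (s≤s z≤n)) (∑ℤ<-cong n (f≡g ∘ s≤s))

∑ℤ<-suc : ∀ n f → ∑ℤ< (suc n) f ≡ ∑ℤ< n f ℤ.+ f n
∑ℤ<-suc zero f = trans (ℤP.+-identityʳ (f 0)) (sym (ℤP.+-identityˡ (f 0)))
∑ℤ<-suc (suc n) f = trans (cong (λ s → f 0 ℤ.+ s) (∑ℤ<-suc n (f ∘ suc))) (sym (ℤP.+-assoc (f 0) _ _))

∑ℤ<-neg : ∀ n (f : ℕ → ℕ) → ∑ℤ< n (λ c → ℤ.- (⁺ f c)) ≡ ℤ.- (⁺ ∑< n f)
∑ℤ<-neg zero f = refl
∑ℤ<-neg (suc n) f = trans (cong (λ s → ℤ.- (⁺ f 0) ℤ.+ s) (∑ℤ<-neg n (f ∘ suc)))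
  (trans (sym (ℤP.neg-distrib-+ (⁺ f 0) (⁺ ∑< n (f ∘ suc)))) (cong ℤ.-_ (sym (ℤP.pos-+ (f 0) _))))

1+H-coeff : ∀ t c → (oneS ⊕ Hs t) c ≡ ⁺ h t c
1+H-coeff t zero = cong ⁺_ (sym (h-zero t))
1+H-coeff t (suc c) = refl

1-G-coeff : ∀ t j → (oneS ⊖ Gs t) (suc j) ≡ ℤ.- (⁺ g t (suc j))
1-G-coeff t j = ℤP.+-identityˡ _

[1+H]⊛[1-G]-term : ∀ t m {c} → c ≤ m →
  (oneS ⊕ Hs t) c ℤ.* (oneS ⊖ Gs t) (suc m ∸ c) ≡ ℤ.- (⁺ (h t c * g t (suc m ∸ c)))
[1+H]⊛[1-G]-term t m {c} c≤m = begin
  (oneS ⊕ Hs t) c ℤ.* (oneS ⊖ Gs t) (suc m ∸ c)   ≡⟨ cong₂ ℤ._*_ (1+H-coeff t c) (cong (oneS ⊖ Gs t) (+-∸-assoc 1 c≤m)) ⟩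
  ⁺ h t c ℤ.* (oneS ⊖ Gs t) (suc (m ∸ c))         ≡⟨ cong (λ s → ⁺ h t c ℤ.* s) (1-G-coeff t (m ∸ c)) ⟩
  ⁺ h t c ℤ.* ℤ.- (⁺ g t (suc (m ∸ c)))           ≡⟨ ℤP.neg-distribʳ-* (⁺ h t c) _ ⟨
  ℤ.- (⁺ h t c ℤ.* ⁺ g t (suc (m ∸ c)))           ≡⟨ cong ℤ.-_ (ℤP.pos-* (h t c) _) ⟨
  ℤ.- (⁺ (h t c * g t (suc (m ∸ c))))             ≡⟨ cong (λ e → ℤ.- (⁺ (h t c * g t e))) (+-∸-assoc 1 c≤m) ⟨
  ℤ.- (⁺ (h t c * g t (suc m ∸ c)))               ∎
  where open ≡-Reasoning

[1+H]⊛[1-G]-last : ∀ t m → (oneS ⊕ Hs t) (suc m) ℤ.* (oneS ⊖ Gs t) (suc m ∸ suc m) ≡ ⁺ h t (suc m)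
[1+H]⊛[1-G]-last t m = trans (cong (λ e → ⁺ h t (suc m) ℤ.* (oneS ⊖ Gs t) e) (n∸n≡0 m)) (ℤP.*-identityʳ _)

lemma3p14 : (t n : ℕ) → ((oneS ⊕ Hs t) ⊛ (oneS ⊖ Gs t)) n ≡ oneS n
lemma3p14 t zero = refl
lemma3p14 t (suc m) = begin
  sumUpTo (suc m) F                                        ≡⟨ sumUpTo≡∑ℤ< (suc m) F ⟩
  ∑ℤ< (suc (suc m)) F                                      ≡⟨ ∑ℤ<-suc (suc m) F ⟩
  ∑ℤ< (suc m) F ℤ.+ F (suc m)                              ≡⟨ cong₂ ℤ._+_ (∑ℤ<-cong (suc m) (λ c< → [1+H]⊛[1-G]-term t m (≤-pred c<)))
                                                                             ([1+H]⊛[1-G]-last t m) ⟩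
  ∑ℤ< (suc m) (λ c → ℤ.- (⁺ term c)) ℤ.+ ⁺ h t (suc m)     ≡⟨ cong₂ ℤ._+_ (∑ℤ<-neg (suc m) term) (cong ⁺_ (h-convolution t m)) ⟩
  ℤ.- (⁺ ∑< (suc m) term) ℤ.+ ⁺ ∑< (suc m) term            ≡⟨ ℤP.+-inverseˡ (⁺ ∑< (suc m) term) ⟩
  ⁺ 0                                                      ∎
  where
  open ≡-Reasoning
  F : ℕ → ℤ
  F c = (oneS ⊕ Hs t) c ℤ.* (oneS ⊖ Gs t) (suc m ∸ c)
  term : ℕ → ℕ
  term c = h t c * g t (suc m ∸ c)
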